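{- Let $p$ be a prime, $m\ge1$, $q=p^m$, $\omega=e^{2\pi i/p}$, and let $g$ be a primitive element of $\mathbb{F}_p^*$. For $i,j\in\mathbb{F}_p$ let $T_{ij}=|\{x\in\mathbb{F}_q^{*}: tr(x)=i,\ tr(x^{ -1})=j\}|$, and put $x_l=T_{1,g^l}$ for $l=0,\ldots,p-2$ and $k_l=\mathcal{K}(g^l)+p+1$, indices of $k$ taken modulo $p-1$. Then for every $s=0,\ldots,p-2$, $$\sum_{l=0}^{p-2}k_{s+l}\,x_l=\mathcal{K}^{(m)}(g^s)+q+1,$$ i.e. $(T_{1s})_{s=1}^{p-1}$ satisfies a linear system whose coefficient matrix is the real left-circulant matrix $\mathbf{K}$ with first row $(k_0,\ldots,k_{p-2})$.
   Context: $tr:\mathbb{F}_q\to\mathbb{F}_p$ is the absolute trace $tr(\gamma)=\sum_{r=0}^{m-1}\gamma^{p^r}$. For $u\in\mathbb{F}_q^*$ the Kloosterman sum is $\mathcal{K}^{(m)}(u)=\sum_{x\in\mathbb{F}_q^*}\omega^{tr(x+u/x)}$, and $\mathcal{K}(u)=\mathcal{K}^{(1)}(u)=\sum_{x\in\mathbb{F}_p^*}\omega^{x+u/x}$ for $u\in\mathbb{F}_p^*$ (exponents read as integers mod $p$). A matrix is left-circulant if its $i$-th row is its first row cyclically shifted left by $i-1$ steps. -}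

module Defs where

open import Level using (Level; _⊔_) renaming (suc to lsuc)
open import Data.Nat using (ℕ; zero; suc; _∸_; _^_; _%_; NonZero)
open import Data.Nat using () renaming (_+_ to _+ℕ_; _*_ to _*ℕ_)
import Data.Nat as ℕ
open import Data.Integer using (ℤ; +_; _-_)
open import Data.Fin using (Fin; toℕ)
import Data.Fin as Fin
open import Data.Bool using (if_then_else_)
open import Data.Product using (_×_; ∃)
open import Relation.Nullary using (¬_; Dec; does)
open import Relation.Nullary.Decidable using (_×-dec_)
open import Relation.Binary using (Decidable)
open import Relation.Binary.PropositionalEquality using (_≡_)
open import Algebra.Bundles using (CommutativeRing)

ΣFin : (n : ℕ) → (Fin n → ℕ) → ℕ
ΣFin zero    f = 0
ΣFin (suc n) f = f Fin.zero +ℕ ΣFin n (λ i → f (Fin.suc i))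

𝟙 : ∀ {a} {A : Set a} → Dec A → ℕ
𝟙 d = if does d then 1 else 0

-- Elements of ℤ[ω], ω = e^{2πi/p}, represented as formal sums
-- Σ_{a ∈ Fin p} c(a) ω^a with c(a) ∈ ℕ.  Since the minimal polynomial
-- of ω over ℚ is 1 + X + ... + X^{p-1}, two such formal sums denote the
-- same complex number iff their coefficient difference is constant.

Cyc : ℕ → Set
Cyc p = Fin p → ℕ

_≈ω_ : ∀ {p} → Cyc p → Cyc p → Set
c ≈ω d = ∃ λ (t : ℤ) → ∀ a → (+ c a) - (+ d a) ≡ t

constω : ∀ {p} → ℕ → Cyc p
constω n a = if does (toℕ a ℕ.≟ 0) then n else 0

IsPrimitiveRoot : (p g : ℕ) → .{{NonZero p}} → Set
IsPrimitiveRoot p g =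
  (0 ℕ.< g) × (g ℕ.< p) ×
  (∀ k → 0 ℕ.< k → k ℕ.< p ∸ 1 → ¬ ((g ^ k) % p ≡ 1))

-- Kloosterman sum over 𝔽_p:  𝒦(u) = Σ_{x ∈ 𝔽_p^*} ω^{x + u/x}.
-- Coefficient of ω^a = #{(x,y) ∈ 𝔽_p² : x y = 1, x + u y = a}.
Kloosterman₁ : (p : ℕ) → .{{NonZero p}} → ℕ → Cyc p
Kloosterman₁ p u a =
  ΣFin p λ x → ΣFin p λ y →
    𝟙 (((toℕ x *ℕ toℕ y) % p ℕ.≟ 1) ×-dec ((toℕ x +ℕ u *ℕ toℕ y) % p ℕ.≟ toℕ a))

record FiniteField (c ℓ : Level) (q : ℕ) : Set (lsuc (c ⊔ ℓ)) where
  field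
    ring : CommutativeRing c ℓ
  open CommutativeRing ring public
    using (Carrier; _≈_; _+_; _*_; 0#; 1#)
  field
    _≟_      : Decidable _≈_
    1≉0      : ¬ (1# ≈ 0#)
    inverse  : ∀ x → ¬ (x ≈ 0#) → ∃ λ y → (x * y) ≈ 1#
    enum     : Fin q → Carrier
    enum-inj : ∀ i j → enum i ≈ enum j → i ≡ j
    enum-sur : ∀ x → ∃ λ i → enum i ≈ x

  pow : Carrier → ℕ → Carrier
  pow x zero    = 1#
  pow x (suc n) = x * pow x n

  nat : ℕ → Carrier
  nat zero    = 0#
  nat (suc n) = 1# + nat n

  ΣR : ℕ → (ℕ → Carrier) → Carrier
  ΣR zero    f = 0#
  ΣR (suc n) f = f n + ΣR n f

module _ {c ℓ q} (F : FiniteField c ℓ q) where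
  open FiniteField F

  trace : (p m : ℕ) → Carrier → Carrier
  trace p m γ = ΣR m (λ r → pow γ (p ^ r))

  -- T_{ij} = #{x ∈ 𝔽_q^* : tr(x) = i, tr(x⁻¹) = j}, counted as the number
  -- of pairs (x,y) with x y = 1 (y = x⁻¹); i, j ∈ 𝔽_p given as residues.
  T : (p m : ℕ) → ℕ → ℕ → ℕ
  T p m i j =
    ΣFin q λ x → ΣFin q λ y →
      𝟙 (((enum x * enum y) ≟ 1#) ×-dec
         ((trace p m (enum x) ≟ nat i) ×-dec (trace p m (enum y) ≟ nat j)))

  -- Kloosterman sum over 𝔽_q: 𝒦^{(m)}(u) = Σ_{x ∈ 𝔽_q^*} ω^{tr(x + u/x)}.
  -- Coefficient of ω^a = #{(x,y) : x y = 1, tr(x + u y) = a}.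
  KloostermanM : (p m : ℕ) → Carrier → Cyc p
  KloostermanM p m u a =
    ΣFin q λ x → ΣFin q λ y →
      𝟙 (((enum x * enum y) ≟ 1#) ×-dec
         (trace p m (enum x + u * enum y) ≟ nat (toℕ a)))

-- Sorting x ∈ 𝔽_q^* by (tr x, tr x⁻¹) = (i, j) ∈ 𝔽ₚ² gives 𝒦^{(m)}(v) = Σ_{i,j} T_{ij} ω^{i + v j}. The
-- substitutions x ↦ λx (λ ∈ 𝔽ₚ^*) and x ↦ x⁻¹ show T_{λi,λ⁻¹j} = T_{ij} = T_{ji}; hence T_{ij} = T_{1,ij}
-- when i, j ≠ 0, and grouping those pairs by c = ij leaves Σ_c T_{1c} 𝒦(vc), the left-hand side once
-- c = g^l. The pairs on the axes add T₀₀ to the coefficient of ω⁰ and 2 T₀₁ to every other coefficient.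
-- Since an element of ℤ[ω] is its coefficient vector up to a constant, it remains to match the constant
-- terms, which follows from counting 𝔽_q^* by trace pairs and from |tr⁻¹(0)| = |tr⁻¹(1)| (translate by an
-- element of trace 1). That tr is 𝔽ₚ-valued, 𝔽ₚ-linear and not identically zero comes from the
-- Frobenius x ↦ x^p and from counting the roots of y^p - y and of tr.

module Submission where

open import Defs
open import Level using (Level)
open import Data.Nat using (ℕ; suc; _+_; _*_; _∸_; _^_; _%_; _≤_; _<_; NonZero)
open import Data.Fin using (Fin; toℕ)
open import Data.Nat.Primality using (Prime)

open import Data.Nat using (zero; z≤n; s≤s; nonTrivial⇒n>1; >-nonZero)
import Data.Nat.Properties as ℕ
open import Data.Fin using (fromℕ; fromℕ<; inject≤) renaming (zero to fzero; suc to fsuc)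
import Data.Fin.Properties as Fin
open import Data.Fin.Permutation using (Permutation; _⟨$⟩ʳ_; permutation)
open import Data.Product using (∃; _×_; _,_; proj₁; proj₂)
open import Data.Sum using (_⊎_; inj₁; inj₂)
open import Relation.Nullary using (¬_; Dec; yes; no)
open import Relation.Nullary.Decidable using (_×-dec_; ¬?)
open import Relation.Nullary.Negation using (contradiction)
open import Relation.Binary.PropositionalEquality as ≡ using (_≡_)
import Algebra.Properties.CommutativeMonoid.Sum as CommutativeMonoidSum
import Algebra.Properties.CommutativeSemigroup as CommutativeSemigroupProperties
import Algebra.Properties.Group as GroupProperties
import Relation.Binary.Reasoning.Setoid as SetoidReasoning
open import Algebra.Bundles using (CommutativeRing)
open import Level using (_⊔_)
open import Relation.Binary.Core using (_Preserves_⟶_; _Preserves₂_⟶_⟶_)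
open import Relation.Binary.Definitions using (tri<; tri≈; tri>)
open import Data.Nat.Primality using (prime⇒nonTrivial; prime⇒nonZero)
import Data.Integer as ℤ
import Data.Integer.Properties as ℤᵖ

module ℕ* = CommutativeSemigroupProperties ℕ.*-commutativeSemigroup

module FinSums where

  open ≡ using (refl; sym; trans; cong; cong₂; subst; module ≡-Reasoning)

  ΣFin-cong : ∀ n {f g : Fin n → ℕ} → (∀ i → f i ≡ g i) → ΣFin n f ≡ ΣFin n g
  ΣFin-cong zero    f≗g = refl
  ΣFin-cong (suc n) f≗g = cong₂ _+_ (f≗g fzero) (ΣFin-cong n (λ i → f≗g (fsuc i)))

  ΣFin-zero : ∀ n → ΣFin n (λ _ → 0) ≡ 0
  ΣFin-zero zero    = refl
  ΣFin-zero (suc n) = ΣFin-zero n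

  ΣFin-one : ∀ n → ΣFin n (λ _ → 1) ≡ n
  ΣFin-one zero    = refl
  ΣFin-one (suc n) = cong suc (ΣFin-one n)

  ΣFin-distrib-+ : ∀ n (f g : Fin n → ℕ) →
    ΣFin n (λ i → f i + g i) ≡ ΣFin n f + ΣFin n g
  ΣFin-distrib-+ zero    f g = refl
  ΣFin-distrib-+ (suc n) f g = begin
    (f fzero + g fzero) + ΣFin n (λ i → f (fsuc i) + g (fsuc i))
      ≡⟨ cong ((f fzero + g fzero) +_) (ΣFin-distrib-+ n _ _) ⟩
    (f fzero + g fzero) + (ΣFin n (λ i → f (fsuc i)) + ΣFin n (λ i → g (fsuc i)))
      ≡⟨ ℕ+.interchange (f fzero) (g fzero) _ _ ⟩
    (f fzero + ΣFin n (λ i → f (fsuc i))) + (g fzero + ΣFin n (λ i → g (fsuc i))) ∎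
    where
    open ≡-Reasoning
    module ℕ+ = CommutativeSemigroupProperties ℕ.+-commutativeSemigroup

  ΣFin-*ˡ : ∀ n k (f : Fin n → ℕ) → ΣFin n (λ i → k * f i) ≡ k * ΣFin n f
  ΣFin-*ˡ zero    k f = sym (ℕ.*-zeroʳ k)
  ΣFin-*ˡ (suc n) k f =
    trans (cong (k * f fzero +_) (ΣFin-*ˡ n k _)) (sym (ℕ.*-distribˡ-+ k (f fzero) _))

  ΣFin-*ʳ : ∀ n k (f : Fin n → ℕ) → ΣFin n (λ i → f i * k) ≡ ΣFin n f * k
  ΣFin-*ʳ n k f = begin
    ΣFin n (λ i → f i * k) ≡⟨ ΣFin-cong n (λ i → ℕ.*-comm (f i) k) ⟩
    ΣFin n (λ i → k * f i) ≡⟨ ΣFin-*ˡ n k f ⟩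
    k * ΣFin n f           ≡⟨ ℕ.*-comm k _ ⟩
    ΣFin n f * k           ∎
    where open ≡-Reasoning

  ΣFin-comm : ∀ n k (f : Fin n → Fin k → ℕ) →
    ΣFin n (λ i → ΣFin k (f i)) ≡ ΣFin k (λ j → ΣFin n (λ i → f i j))
  ΣFin-comm zero    k f = sym (ΣFin-zero k)
  ΣFin-comm (suc n) k f = begin
    ΣFin k (f fzero) + ΣFin n (λ i → ΣFin k (f (fsuc i)))
      ≡⟨ cong (ΣFin k (f fzero) +_) (ΣFin-comm n k (λ i → f (fsuc i))) ⟩
    ΣFin k (f fzero) + ΣFin k (λ j → ΣFin n (λ i → f (fsuc i) j))
      ≡⟨ sym (ΣFin-distrib-+ k (f fzero) _) ⟩
    ΣFin k (λ j → ΣFin (suc n) (λ i → f i j)) ∎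
    where open ≡-Reasoning

  module ℕSum = CommutativeMonoidSum ℕ.+-0-commutativeMonoid

  ΣFin≡sum : ∀ n (f : Fin n → ℕ) → ΣFin n f ≡ ℕSum.sum f
  ΣFin≡sum zero    f = refl
  ΣFin≡sum (suc n) f = cong (f fzero +_) (ΣFin≡sum n (λ i → f (fsuc i)))

  ΣFin-permute : ∀ n (π : Permutation n n) (f : Fin n → ℕ) →
    ΣFin n f ≡ ΣFin n (λ i → f (π ⟨$⟩ʳ i))
  ΣFin-permute n π f =
    trans (ΣFin≡sum n f) (trans (ℕSum.sum-permute f π) (sym (ΣFin≡sum n _)))

  𝟙-cong : ∀ {a b} {A : Set a} {B : Set b} → (A → B) → (B → A) →
    (A? : Dec A) (B? : Dec B) → 𝟙 A? ≡ 𝟙 B?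
  𝟙-cong A→B B→A (yes a) (yes b) = refl
  𝟙-cong A→B B→A (yes a) (no ¬b) = contradiction (A→B a) ¬b
  𝟙-cong A→B B→A (no ¬a) (yes b) = contradiction (B→A b) ¬a
  𝟙-cong A→B B→A (no ¬a) (no ¬b) = refl

  𝟙-× : ∀ {a b} {A : Set a} {B : Set b} (A? : Dec A) (B? : Dec B) →
    𝟙 (A? ×-dec B?) ≡ 𝟙 A? * 𝟙 B?
  𝟙-× (yes _) (yes _) = refl
  𝟙-× (yes _) (no _)  = refl
  𝟙-× (no _)  (yes _) = refl
  𝟙-× (no _)  (no _)  = refl

  𝟙-yes : ∀ {a} {A : Set a} (A? : Dec A) → A → 𝟙 A? ≡ 1
  𝟙-yes (yes _) _ = refl
  𝟙-yes (no ¬a) a = contradiction a ¬a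

  𝟙-no : ∀ {a} {A : Set a} (A? : Dec A) → ¬ A → 𝟙 A? ≡ 0
  𝟙-no (yes a) ¬a = contradiction a ¬a
  𝟙-no (no _)  _  = refl

  ΣFin-𝟙-none : ∀ n {a} {P : Fin n → Set a} (P? : ∀ i → Dec (P i)) (f : Fin n → ℕ) →
    (∀ i → ¬ P i) → ΣFin n (λ i → 𝟙 (P? i) * f i) ≡ 0
  ΣFin-𝟙-none n P? f none =
    trans (ΣFin-cong n (λ i → cong (_* f i) (𝟙-no (P? i) (none i)))) (ΣFin-zero n)

  ΣFin-δ : ∀ n {a} {P : Fin n → Set a} (P? : ∀ i → Dec (P i)) (f : Fin n → ℕ) (j : Fin n) →
    (∀ i → P i → i ≡ j) → P j → ΣFin n (λ i → 𝟙 (P? i) * f i) ≡ f j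
  ΣFin-δ (suc n) P? f fzero only-j Pj rewrite 𝟙-yes (P? fzero) Pj =
    trans (cong₂ _+_ (ℕ.*-identityˡ (f fzero)) rest-vanishes) (ℕ.+-identityʳ (f fzero))
    where
    rest-vanishes : ΣFin n (λ i → 𝟙 (P? (fsuc i)) * f (fsuc i)) ≡ 0
    rest-vanishes = ΣFin-𝟙-none n (λ i → P? (fsuc i)) (λ i → f (fsuc i))
      (λ i Pi → Fin.0≢1+n (sym (only-j (fsuc i) Pi)))
  ΣFin-δ (suc n) P? f (fsuc j) only-j Pj
    rewrite 𝟙-no (P? fzero) (λ P0 → Fin.0≢1+n (only-j fzero P0)) =
    ΣFin-δ n (λ i → P? (fsuc i)) (λ i → f (fsuc i)) j
      (λ i Pi → Fin.suc-injective (only-j (fsuc i) Pi)) Pj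

  ΣFin-𝟙≤1 : ∀ n {a} {P : Fin n → Set a} (P? : ∀ i → Dec (P i)) →
    (∀ i j → P i → P j → i ≡ j) → ΣFin n (λ i → 𝟙 (P? i)) ≤ 1
  ΣFin-𝟙≤1 zero    P? unique = z≤n
  ΣFin-𝟙≤1 (suc n) P? unique with P? fzero
  ... | yes P0 = ℕ.≤-reflexive (cong suc (trans
        (ΣFin-cong n (λ i → 𝟙-no (P? (fsuc i)) (λ Pi → Fin.0≢1+n (unique _ _ P0 Pi))))
        (ΣFin-zero n)))
  ... | no _   = ΣFin-𝟙≤1 n (λ i → P? (fsuc i)) (λ i j Pi Pj → Fin.suc-injective (unique _ _ Pi Pj))

  ΣFin-≤1 : ∀ n (f : Fin n → ℕ) → (∀ i → f i ≤ 1) → ΣFin n f ≤ n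
  ΣFin-≤1 zero    f f≤1 = z≤n
  ΣFin-≤1 (suc n) f f≤1 = ℕ.+-mono-≤ (f≤1 fzero) (ΣFin-≤1 n (λ i → f (fsuc i)) (λ i → f≤1 (fsuc i)))

  ΣFin≡n⇒≡1 : ∀ n (f : Fin n → ℕ) → (∀ i → f i ≤ 1) → ΣFin n f ≡ n → ∀ i → f i ≡ 1
  ΣFin≡n⇒≡1 (suc n) f f≤1 ΣFin≡n = go
    where
    rest = ΣFin n (λ i → f (fsuc i))
    rest≤n : rest ≤ n
    rest≤n = ΣFin-≤1 n (λ i → f (fsuc i)) (λ i → f≤1 (fsuc i))
    head≡1 : f fzero ≡ 1
    head≡1 = ℕ.≤-antisym (f≤1 fzero)
      (ℕ.+-cancelʳ-≤ n 1 (f fzero) (subst (_≤ f fzero + n) ΣFin≡n (ℕ.+-monoʳ-≤ (f fzero) rest≤n)))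
    go : ∀ i → f i ≡ 1
    go fzero    = head≡1
    go (fsuc i) = ΣFin≡n⇒≡1 n (λ i → f (fsuc i)) (λ i → f≤1 (fsuc i))
      (ℕ.+-cancelˡ-≡ 1 _ _ (trans (cong (_+ rest) (sym head≡1)) ΣFin≡n)) i

open FinSums

≈ω-offset : ∀ {p} {f g : Cyc p} k → (∀ a → f a + k ≡ g a) → f ≈ω g
≈ω-offset {f = f} {g} k f+k≡g = ℤ.- ℤ.+ k , λ a → begin
  ℤ.+ f a ℤ.- ℤ.+ g a             ≡⟨ ≡.cong (λ n → ℤ.+ f a ℤ.- ℤ.+ n) (≡.sym (f+k≡g a)) ⟩
  ℤ.+ f a ℤ.- ℤ.+ (f a + k)       ≡⟨ ℤᵖ.[+m]-[+n]≡m⊖n (f a) (f a + k) ⟩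
  f a ℤ.⊖ (f a + k)               ≡⟨ ℤᵖ.⊖-≤ (ℕ.m≤m+n (f a) k) ⟩
  ℤ.- ℤ.+ (f a + k ∸ f a)         ≡⟨ ≡.cong (λ n → ℤ.- ℤ.+ n) (ℕ.m+n∸m≡n (f a) k) ⟩
  ℤ.- ℤ.+ k                       ∎
  where open ≡.≡-Reasoning

module NatArithmetic where

  open import Data.Nat.Combinatorics using (_C_; nC1≡n; nCk+nC[k+1]≡[n+1]C[k+1])
  open import Data.Nat.Divisibility using (_∣_; divides; ∣⇒≤)
  open import Data.Nat.Primality using (euclidsLemma)
  open import Data.Nat.Solver using (module +-*-Solver)
  open +-*-Solver using (solve; _:+_; _:*_; _:=_; con)
  open ≡ using (refl; sym; trans; cong; cong₂)

  [1+k]*[1+n]C[1+k]≡[1+n]*nCk : ∀ n k → suc k * (suc n C suc k) ≡ suc n * (n C k)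
  [1+k]*[1+n]C[1+k]≡[1+n]*nCk zero    zero    = refl
  [1+k]*[1+n]C[1+k]≡[1+n]*nCk zero    (suc k) = ℕ.*-zeroʳ (suc (suc k))
  [1+k]*[1+n]C[1+k]≡[1+n]*nCk (suc n) zero    =
    trans (ℕ.*-identityˡ _) (trans (nC1≡n (suc (suc n))) (sym (ℕ.*-identityʳ _)))
  [1+k]*[1+n]C[1+k]≡[1+n]*nCk (suc n) (suc k) = begin
    suc (suc k) * (suc (suc n) C suc (suc k))
      ≡⟨ cong (suc (suc k) *_) (sym (nCk+nC[k+1]≡[n+1]C[k+1] (suc n) (suc k))) ⟩
    suc (suc k) * (X + Y)
      ≡⟨ solve 3 (λ k X Y → (con 2 :+ k) :* (X :+ Y) := X :+ ((con 1 :+ k) :* X :+ (con 2 :+ k) :* Y)) refl k X Y ⟩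
    X + (suc k * X + suc (suc k) * Y)
      ≡⟨ cong (X +_) (cong₂ _+_ ([1+k]*[1+n]C[1+k]≡[1+n]*nCk n k) ([1+k]*[1+n]C[1+k]≡[1+n]*nCk n (suc k))) ⟩
    X + (suc n * (n C k) + suc n * (n C suc k))
      ≡⟨ cong (X +_) (sym (ℕ.*-distribˡ-+ (suc n) (n C k) _)) ⟩
    X + suc n * (n C k + n C suc k)
      ≡⟨ cong (λ t → X + suc n * t) (nCk+nC[k+1]≡[n+1]C[k+1] n k) ⟩
    suc (suc n) * X ∎
    where
    open ≡.≡-Reasoning
    X = suc n C suc k
    Y = suc n C suc (suc k)

  p∣pCk : ∀ {p} → Prime p → ∀ {k} → 0 < k → k < p → p ∣ (p C k)
  p∣pCk {suc n} p-prime {suc k} 0<k k<p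
    with euclidsLemma (suc k) (suc n C suc k) p-prime
           (divides (n C k) (trans ([1+k]*[1+n]C[1+k]≡[1+n]*nCk n k) (ℕ.*-comm (suc n) _)))
  ... | inj₁ p∣1+k  = contradiction (∣⇒≤ p∣1+k) (ℕ.<⇒≱ k<p)
  ... | inj₂ p∣pCk′ = p∣pCk′

  -- The ω⁰-coefficient identity; its hypotheses are the count of 𝔽_q^* by trace pairs and the balance of the trace.
  constant-term-identity : ∀ {n T₀₀ T₀₁ S q} M →
    q ≡ T₀₀ + (n + n) * T₀₁ + S * n + 1 → T₀₀ + n * T₀₁ + 1 ≡ T₀₁ + S →
    (M + (suc n + 1) * S) + 2 * T₀₁ ≡ (T₀₀ + M) + (q + 1)
  constant-term-identity {n} {T₀₀} {T₀₁} {S} {q} M q≡ balance = begin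
    (M + (suc n + 1) * S) + 2 * T₀₁
      ≡⟨ solve 4 (λ M n N S → (M :+ (con 1 :+ n :+ con 1) :* S) :+ con 2 :* N := M :+ S :* n :+ con 2 :* (N :+ S))
           refl M n T₀₁ S ⟩
    M + S * n + 2 * (T₀₁ + S)
      ≡⟨ cong (λ x → M + S * n + 2 * x) (sym balance) ⟩
    M + S * n + 2 * (T₀₀ + n * T₀₁ + 1)
      ≡⟨ solve 5 (λ M n T₀₀ N S → M :+ S :* n :+ con 2 :* (T₀₀ :+ n :* N :+ con 1)
                                 := (T₀₀ :+ M) :+ ((T₀₀ :+ (n :+ n) :* N :+ S :* n :+ con 1) :+ con 1))
           refl M n T₀₀ T₀₁ S ⟩
    (T₀₀ + M) + ((T₀₀ + (n + n) * T₀₁ + S * n + 1) + 1)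
      ≡⟨ cong (λ x → (T₀₀ + M) + (x + 1)) (sym q≡) ⟩
    (T₀₀ + M) + (q + 1) ∎
    where open ≡.≡-Reasoning

open NatArithmetic

module FieldProperties {c ℓ q} (F : FiniteField c ℓ q) where

  open FiniteField F public using (_≟_; 1≉0; enum; pow; nat; ΣR)
  open FiniteField F using (inverse; enum-inj; enum-sur; ring)
  open CommutativeRing ring public hiding (zero) renaming (_+_ to _⊕_; _*_ to _⊗_)
  open GroupProperties +-group public
    using (identityʳ-unique; x∙y⁻¹≈ε⇒x≈y) renaming (∙-cancelˡ to +-cancelˡ; ∙-cancelʳ to +-cancelʳ)
  open CommutativeSemigroupProperties *-commutativeSemigroup public
    using () renaming (interchange to *-interchange)
  open CommutativeSemigroupProperties +-commutativeSemigroup public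
    using () renaming (interchange to +-interchange)
  open CommutativeMonoidSum +-commutativeMonoid public using (sum; sum-permute; sum-cong-≋; ∑-distrib-+)
  open CommutativeMonoidSum *-commutativeMonoid public
    using () renaming (sum to product; sum-permute to product-permute; sum-cong-≋ to product-cong)
  open import Algebra.Solver.Ring.NaturalCoefficients.Default commutativeSemiring public
    using (solve; _:+_; _:*_; _:=_; con)
  open import Algebra.Properties.Semiring.Exp semiring public using () renaming (_^_ to _^ᴿ_)
  open import Algebra.Properties.Monoid.Mult +-monoid public using () renaming (_×_ to _×ᴿ_)
  module ≈-Reasoning = SetoidReasoning setoid

  inv : Carrier → Carrier
  inv x with x ≟ 0#
  ... | yes _  = 0#
  ... | no x≉0 = proj₁ (inverse x x≉0)

  *-inverseʳ : ∀ x → ¬ x ≈ 0# → x ⊗ inv x ≈ 1#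
  *-inverseʳ x x≉0 with x ≟ 0#
  ... | yes x≈0 = contradiction x≈0 x≉0
  ... | no x≉0′ = proj₂ (inverse x x≉0′)

  *-inverseˡ : ∀ x → ¬ x ≈ 0# → inv x ⊗ x ≈ 1#
  *-inverseˡ x x≉0 = trans (*-comm _ _) (*-inverseʳ x x≉0)

  inv-0# : ∀ {x} → x ≈ 0# → inv x ≈ 0#
  inv-0# {x} x≈0 with x ≟ 0#
  ... | yes _  = refl
  ... | no x≉0 = contradiction x≈0 x≉0

  *-inv-cancelˡ : ∀ {x} → ¬ x ≈ 0# → ∀ y → x ⊗ (inv x ⊗ y) ≈ y
  *-inv-cancelˡ {x} x≉0 y = trans (sym (*-assoc _ _ _)) (trans (*-congʳ (*-inverseʳ x x≉0)) (*-identityˡ y))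

  inv-*-cancelˡ : ∀ {x} → ¬ x ≈ 0# → ∀ y → inv x ⊗ (x ⊗ y) ≈ y
  inv-*-cancelˡ {x} x≉0 y = trans (sym (*-assoc _ _ _)) (trans (*-congʳ (*-inverseˡ x x≉0)) (*-identityˡ y))

  *-cancelˡ-nonzero : ∀ {x y z} → ¬ x ≈ 0# → x ⊗ y ≈ x ⊗ z → y ≈ z
  *-cancelˡ-nonzero {x} {y} {z} x≉0 xy≈xz =
    trans (sym (inv-*-cancelˡ x≉0 y)) (trans (*-congˡ xy≈xz) (inv-*-cancelˡ x≉0 z))

  x*y≈0⇒x≈0⊎y≈0 : ∀ {x y} → x ⊗ y ≈ 0# → x ≈ 0# ⊎ y ≈ 0#
  x*y≈0⇒x≈0⊎y≈0 {x} {y} xy≈0 with x ≟ 0#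
  ... | yes x≈0 = inj₁ x≈0
  ... | no x≉0  = inj₂ (*-cancelˡ-nonzero x≉0 (trans xy≈0 (sym (zeroʳ x))))

  *-nonzero : ∀ {x y} → ¬ x ≈ 0# → ¬ y ≈ 0# → ¬ x ⊗ y ≈ 0#
  *-nonzero x≉0 y≉0 xy≈0 with x*y≈0⇒x≈0⊎y≈0 xy≈0
  ... | inj₁ x≈0 = x≉0 x≈0
  ... | inj₂ y≈0 = y≉0 y≈0

  inv-nonzero : ∀ {x} → ¬ x ≈ 0# → ¬ inv x ≈ 0#
  inv-nonzero {x} x≉0 inv≈0 =
    1≉0 (trans (sym (*-inverseʳ x x≉0)) (trans (*-congˡ inv≈0) (zeroʳ x)))

  inverse-unique : ∀ {x y} → ¬ x ≈ 0# → x ⊗ y ≈ 1# → y ≈ inv x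
  inverse-unique {x} x≉0 xy≈1 = *-cancelˡ-nonzero x≉0 (trans xy≈1 (sym (*-inverseʳ x x≉0)))

  inv-cong : ∀ {x y} → x ≈ y → inv x ≈ inv y
  inv-cong {x} {y} x≈y = by-cases (x ≟ 0#)
    where
    by-cases : Dec (x ≈ 0#) → inv x ≈ inv y
    by-cases (yes x≈0) = trans (inv-0# x≈0) (sym (inv-0# (trans (sym x≈y) x≈0)))
    by-cases (no x≉0)  = sym (inverse-unique x≉0
      (trans (*-congʳ x≈y) (*-inverseʳ y (λ y≈0 → x≉0 (trans x≈y y≈0)))))

  inv-involutive : ∀ x → inv (inv x) ≈ x
  inv-involutive x = by-cases (x ≟ 0#)
    where
    by-cases : Dec (x ≈ 0#) → inv (inv x) ≈ x
    by-cases (yes x≈0) = trans (inv-0# (inv-0# x≈0)) (sym x≈0)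
    by-cases (no x≉0)  = sym (inverse-unique (inv-nonzero x≉0) (*-inverseˡ x x≉0))

  inv-distrib-⊗ : ∀ {x y} → ¬ x ≈ 0# → ¬ y ≈ 0# → inv (x ⊗ y) ≈ inv x ⊗ inv y
  inv-distrib-⊗ {x} {y} x≉0 y≉0 = sym (inverse-unique (*-nonzero x≉0 y≉0) (begin
    (x ⊗ y) ⊗ (inv x ⊗ inv y) ≈⟨ *-interchange x y (inv x) (inv y) ⟩
    (x ⊗ inv x) ⊗ (y ⊗ inv y) ≈⟨ *-cong (*-inverseʳ x x≉0) (*-inverseʳ y y≉0) ⟩
    1# ⊗ 1#                   ≈⟨ *-identityˡ 1# ⟩
    1#                        ∎))
    where open ≈-Reasoning

  pow-cong : ∀ {x y} n → x ≈ y → pow x n ≈ pow y n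
  pow-cong zero    x≈y = refl
  pow-cong (suc n) x≈y = *-cong x≈y (pow-cong n x≈y)

  pow-+ : ∀ x m n → pow x (m + n) ≈ pow x m ⊗ pow x n
  pow-+ x zero    n = sym (*-identityˡ _)
  pow-+ x (suc m) n = trans (*-congˡ (pow-+ x m n)) (sym (*-assoc _ _ _))

  pow-* : ∀ x m n → pow x (m * n) ≈ pow (pow x m) n
  pow-* x m zero    rewrite ℕ.*-zeroʳ m = refl
  pow-* x m (suc n) rewrite ℕ.*-suc m n = trans (pow-+ x m (m * n)) (*-congˡ (pow-* x m n))

  pow-distrib-⊗ : ∀ x y n → pow (x ⊗ y) n ≈ pow x n ⊗ pow y n
  pow-distrib-⊗ x y zero    = sym (*-identityˡ 1#)
  pow-distrib-⊗ x y (suc n) = trans (*-congˡ (pow-distrib-⊗ x y n)) (*-interchange x y _ _)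

  pow-1# : ∀ n → pow 1# n ≈ 1#
  pow-1# zero    = refl
  pow-1# (suc n) = trans (*-identityˡ _) (pow-1# n)

  pow≈0⇒≈0 : ∀ {x} n → pow x n ≈ 0# → x ≈ 0#
  pow≈0⇒≈0 zero    1≈0 = contradiction 1≈0 1≉0
  pow≈0⇒≈0 (suc n) xxⁿ≈0 with x*y≈0⇒x≈0⊎y≈0 xxⁿ≈0
  ... | inj₁ x≈0  = x≈0
  ... | inj₂ xⁿ≈0 = pow≈0⇒≈0 n xⁿ≈0

  pow-nonzero : ∀ {x} n → ¬ x ≈ 0# → ¬ pow x n ≈ 0#
  pow-nonzero n x≉0 xⁿ≈0 = x≉0 (pow≈0⇒≈0 n xⁿ≈0)

  nat-+ : ∀ m n → nat (m + n) ≈ nat m ⊕ nat n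
  nat-+ zero    n = sym (+-identityˡ _)
  nat-+ (suc m) n = trans (+-congˡ (nat-+ m n)) (sym (+-assoc _ _ _))

  nat-* : ∀ m n → nat (m * n) ≈ nat m ⊗ nat n
  nat-* zero    n = sym (zeroˡ _)
  nat-* (suc m) n = begin
    nat (n + m * n)              ≈⟨ nat-+ n (m * n) ⟩
    nat n ⊕ nat (m * n)          ≈⟨ +-cong (sym (*-identityˡ (nat n))) (nat-* m n) ⟩
    1# ⊗ nat n ⊕ nat m ⊗ nat n  ≈⟨ sym (distribʳ (nat n) 1# (nat m)) ⟩
    (1# ⊕ nat m) ⊗ nat n         ∎
    where open ≈-Reasoning

  nat-^ : ∀ m n → nat (m ^ n) ≈ pow (nat m) n
  nat-^ m zero    = +-identityʳ 1#
  nat-^ m (suc n) = trans (nat-* m (m ^ n)) (*-congˡ (nat-^ m n))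

  index : Carrier → Fin q
  index x = proj₁ (enum-sur x)

  enum-index : ∀ x → enum (index x) ≈ x
  enum-index x = proj₂ (enum-sur x)

  enum-injective : ∀ {i j} → enum i ≈ enum j → i ≡ j
  enum-injective = enum-inj _ _

  record Bijection : Set (c ⊔ ℓ) where
    field
      to from   : Carrier → Carrier
      to-cong   : ∀ {x y} → x ≈ y → to x ≈ to y
      from-cong : ∀ {x y} → x ≈ y → from x ≈ from y
      from-to   : ∀ x → from (to x) ≈ x
      to-from   : ∀ x → to (from x) ≈ x

  permute : Bijection → Permutation q q
  permute b = permutation (λ i → index (to (enum i))) (λ i → index (from (enum i)))
    (λ i → enum-injective (trans (enum-index _) (trans (to-cong (enum-index _)) (to-from _))))
    (λ i → enum-injective (trans (enum-index _) (trans (from-cong (enum-index _)) (from-to _))))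
    where open Bijection b

  enum-permute : ∀ b i → enum (permute b ⟨$⟩ʳ i) ≈ Bijection.to b (enum i)
  enum-permute b i = enum-index _

  translation : Carrier → Bijection
  translation a = record
    { to = _⊕ a ; from = _⊕ - a ; to-cong = +-congʳ ; from-cong = +-congʳ
    ; from-to = λ x → trans (+-assoc _ _ _) (trans (+-congˡ (-‿inverseʳ a)) (+-identityʳ x))
    ; to-from = λ x → trans (+-assoc _ _ _) (trans (+-congˡ (-‿inverseˡ a)) (+-identityʳ x))
    }

  scaling : ∀ a → ¬ a ≈ 0# → Bijection
  scaling a a≉0 = record
    { to = a ⊗_ ; from = inv a ⊗_ ; to-cong = *-congˡ ; from-cong = *-congˡ
    ; from-to = inv-*-cancelˡ a≉0 ; to-from = *-inv-cancelˡ a≉0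
    }

  inversion : Bijection
  inversion = record
    { to = inv ; from = inv ; to-cong = inv-cong ; from-cong = inv-cong
    ; from-to = inv-involutive ; to-from = inv-involutive
    }

  ΣFin-bijection : ∀ b (f : Fin q → ℕ) → ΣFin q f ≡ ΣFin q (λ i → f (permute b ⟨$⟩ʳ i))
  ΣFin-bijection b f = ΣFin-permute q (permute b) f

  sum-1# : ∀ n → sum {n} (λ _ → 1#) ≈ nat n
  sum-1# zero    = refl
  sum-1# (suc n) = +-congˡ (sum-1# n)

  -- Translation by 1 permutes the field, so Σ x = Σ (x + 1) = Σ x + q·1.
  nat-q≈0 : nat q ≈ 0#
  nat-q≈0 = identityʳ-unique (sum enum) (nat q) (sym (begin
    sum enum                                       ≈⟨ sum-permute enum π ⟩
    sum (λ i → enum (π ⟨$⟩ʳ i))                     ≈⟨ sum-cong-≋ (enum-permute (translation 1#)) ⟩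
    sum (λ i → enum i ⊕ 1#)                         ≈⟨ ∑-distrib-+ enum (λ _ → 1#) ⟩
    sum enum ⊕ sum {q} (λ _ → 1#)                   ≈⟨ +-congˡ (sum-1# q) ⟩
    sum enum ⊕ nat q                                ∎))
    where
    open ≈-Reasoning
    π = permute (translation 1#)

  isNonzero : Fin q → ℕ
  isNonzero i = 𝟙 (¬? (enum i ≟ 0#))

  isZero : Fin q → ℕ
  isZero i = 𝟙 (enum i ≟ 0#)

  isNonzero+isZero≡1 : ∀ i → isNonzero i + isZero i ≡ 1
  isNonzero+isZero≡1 i with enum i ≟ 0#
  ... | yes _ = ≡.refl
  ... | no _  = ≡.refl

  ΣFin-split-zero : ∀ (f : Fin q → ℕ) → ΣFin q f ≡ ΣFin q (λ i → isNonzero i * f i) + f (index 0#)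
  ΣFin-split-zero f = begin
    ΣFin q f
      ≡⟨ ΣFin-cong q (λ i → ≡.sym (≡.trans (≡.cong (_* f i) (isNonzero+isZero≡1 i)) (ℕ.+-identityʳ (f i)))) ⟩
    ΣFin q (λ i → (isNonzero i + isZero i) * f i)
      ≡⟨ ΣFin-cong q (λ i → ℕ.*-distribʳ-+ (f i) (isNonzero i) (isZero i)) ⟩
    ΣFin q (λ i → isNonzero i * f i + isZero i * f i)
      ≡⟨ ΣFin-distrib-+ q _ _ ⟩
    ΣFin q (λ i → isNonzero i * f i) + ΣFin q (λ i → isZero i * f i)
      ≡⟨ ≡.cong (ΣFin q (λ i → isNonzero i * f i) +_) (ΣFin-δ q (λ i → enum i ≟ 0#) f (index 0#)
           (λ i i≈0 → enum-injective (trans i≈0 (sym (enum-index 0#)))) (enum-index 0#)) ⟩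
    ΣFin q (λ i → isNonzero i * f i) + f (index 0#)       ∎
    where open ≡.≡-Reasoning

  nonzero-count : ΣFin q isNonzero + 1 ≡ q
  nonzero-count = ≡.sym (begin
    q                                        ≡⟨ ≡.sym (ΣFin-one q) ⟩
    ΣFin q (λ _ → 1)                         ≡⟨ ΣFin-split-zero (λ _ → 1) ⟩
    ΣFin q (λ i → isNonzero i * 1) + 1
      ≡⟨ ≡.cong (_+ 1) (ΣFin-cong q (λ i → ℕ.*-identityʳ (isNonzero i))) ⟩
    ΣFin q isNonzero + 1                     ∎)
    where open ≡.≡-Reasoning

  product-pow : ∀ n (k : Fin n → ℕ) (f : Fin n → Carrier) x →
    product (λ i → pow x (k i) ⊗ f i) ≈ pow x (ΣFin n k) ⊗ product f
  product-pow zero    k f x = sym (*-identityˡ 1#)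
  product-pow (suc n) k f x = begin
    (pow x (k fzero) ⊗ f fzero) ⊗ product (λ i → pow x (k (fsuc i)) ⊗ f (fsuc i))
      ≈⟨ *-congˡ (product-pow n (λ i → k (fsuc i)) (λ i → f (fsuc i)) x) ⟩
    (pow x (k fzero) ⊗ f fzero) ⊗ (pow x (ΣFin n (λ i → k (fsuc i))) ⊗ product (λ i → f (fsuc i)))
      ≈⟨ *-interchange _ _ _ _ ⟩
    (pow x (k fzero) ⊗ pow x (ΣFin n (λ i → k (fsuc i)))) ⊗ (f fzero ⊗ product (λ i → f (fsuc i)))
      ≈⟨ *-congʳ (sym (pow-+ x (k fzero) _)) ⟩
    pow x (ΣFin (suc n) k) ⊗ product f ∎
    where open ≈-Reasoning

  product-nonzero : ∀ n (f : Fin n → Carrier) → (∀ i → ¬ f i ≈ 0#) → ¬ product f ≈ 0#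
  product-nonzero zero    f f≉0 = 1≉0
  product-nonzero (suc n) f f≉0 =
    *-nonzero (f≉0 fzero) (product-nonzero n (λ i → f (fsuc i)) (λ i → f≉0 (fsuc i)))

  product≈0⇒ : ∀ n (f : Fin n → Carrier) → product f ≈ 0# → ∃ λ i → f i ≈ 0#
  product≈0⇒ zero    f 1≈0  = contradiction 1≈0 1≉0
  product≈0⇒ (suc n) f ∏≈0 with x*y≈0⇒x≈0⊎y≈0 ∏≈0
  ... | inj₁ f0≈0 = fzero , f0≈0
  ... | inj₂ ∏′≈0 with product≈0⇒ n (λ i → f (fsuc i)) ∏′≈0
  ... | i , fi≈0 = fsuc i , fi≈0

  nonzeroPart : Carrier → Carrier
  nonzeroPart z with z ≟ 0#
  ... | yes _ = 1#
  ... | no _  = z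

  nonzeroPart-nonzero : ∀ z → ¬ nonzeroPart z ≈ 0#
  nonzeroPart-nonzero z with z ≟ 0#
  ... | yes _  = 1≉0
  ... | no z≉0 = z≉0

  nonzeroPart-cong : ∀ {y z} → y ≈ z → nonzeroPart y ≈ nonzeroPart z
  nonzeroPart-cong {y} {z} y≈z with y ≟ 0# | z ≟ 0#
  ... | yes _   | yes _   = refl
  ... | yes y≈0 | no z≉0  = contradiction (trans (sym y≈z) y≈0) z≉0
  ... | no y≉0  | yes z≈0 = contradiction (trans y≈z z≈0) y≉0
  ... | no _    | no _    = y≈z

  nonzeroPart-scale : ∀ x z → ¬ x ≈ 0# →
    nonzeroPart (x ⊗ z) ≈ pow x (𝟙 (¬? (z ≟ 0#))) ⊗ nonzeroPart z
  nonzeroPart-scale x z x≉0 with z ≟ 0# | (x ⊗ z) ≟ 0#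
  ... | yes _   | yes _    = sym (*-identityˡ 1#)
  ... | yes z≈0 | no xz≉0  = contradiction (trans (*-congˡ z≈0) (zeroʳ x)) xz≉0
  ... | no z≉0  | yes xz≈0 = contradiction xz≈0 (*-nonzero x≉0 z≉0)
  ... | no _    | no _     = *-congʳ (sym (*-identityʳ x))

  -- Scaling by x ≉ 0 permutes the field: comparing the products of the nonzero
  -- elements before and after gives x^(q-1) = 1.
  x^q≈x : ∀ x → pow x q ≈ x
  x^q≈x x = ≡.subst (λ n → pow x n ≈ x) nonzero-count (by-cases (x ≟ 0#))
    where
    N = ΣFin q isNonzero
    by-cases : Dec (x ≈ 0#) → pow x (N + 1) ≈ x
    by-cases (yes x≈0) = trans (pow-cong (N + 1) x≈0)
      (trans (≡.subst (λ n → pow 0# n ≈ 0#) (ℕ.+-comm 1 N) (zeroˡ _)) (sym x≈0))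
    by-cases (no x≉0)  = trans (pow-+ x N 1) (trans (*-cong xᴺ≈1 (*-identityʳ x)) (*-identityˡ x))
      where
      P = product (λ i → nonzeroPart (enum i))
      P≈xᴺP : P ≈ pow x N ⊗ P
      P≈xᴺP = begin
        P                                              ≈⟨ product-permute _ (permute (scaling x x≉0)) ⟩
        product (λ i → nonzeroPart (enum (permute (scaling x x≉0) ⟨$⟩ʳ i)))
          ≈⟨ product-cong (λ i → nonzeroPart-cong (enum-permute (scaling x x≉0) i)) ⟩
        product (λ i → nonzeroPart (x ⊗ enum i))
          ≈⟨ product-cong (λ i → nonzeroPart-scale x (enum i) x≉0) ⟩
        product (λ i → pow x (isNonzero i) ⊗ nonzeroPart (enum i))
          ≈⟨ product-pow q isNonzero _ x ⟩
        pow x N ⊗ P                                    ∎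
        where open ≈-Reasoning
      xᴺ≈1 : pow x N ≈ 1#
      xᴺ≈1 = sym (*-cancelˡ-nonzero (product-nonzero q _ (λ i → nonzeroPart-nonzero (enum i)))
        (trans (*-identityʳ P) (trans P≈xᴺP (*-comm _ _))))

  𝟙-≈ : ∀ {a b a′ b′} → a ≈ a′ → b ≈ b′ → 𝟙 (a ≟ b) ≡ 𝟙 (a′ ≟ b′)
  𝟙-≈ {a} {b} {a′} {b′} a≈a′ b≈b′ = 𝟙-cong
    (λ a≈b → trans (sym a≈a′) (trans a≈b b≈b′))
    (λ a′≈b′ → trans a≈a′ (trans a′≈b′ (sym b≈b′)))
    (a ≟ b) (a′ ≟ b′)

  𝟙-*-cancelˡ : ∀ {u v w} → ¬ u ≈ 0# → 𝟙 ((u ⊗ v) ≟ (u ⊗ w)) ≡ 𝟙 (v ≟ w)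
  𝟙-*-cancelˡ {u} {v} {w} u≉0 = 𝟙-cong (*-cancelˡ-nonzero u≉0) *-congˡ ((u ⊗ v) ≟ (u ⊗ w)) (v ≟ w)

  Σ* : (Carrier → ℕ) → ℕ
  Σ* Φ = ΣFin q (λ i → isNonzero i * Φ (enum i))

  Σ*-cong : ∀ {Φ Ψ} → (∀ x → ¬ x ≈ 0# → Φ x ≡ Ψ x) → Σ* Φ ≡ Σ* Ψ
  Σ*-cong {Φ} {Ψ} Φ≡Ψ = ΣFin-cong q pointwise
    where
    pointwise : ∀ i → isNonzero i * Φ (enum i) ≡ isNonzero i * Ψ (enum i)
    pointwise i with enum i ≟ 0#
    ... | yes _  = ≡.refl
    ... | no x≉0 = ≡.cong (_+ 0) (Φ≡Ψ (enum i) x≉0)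

  Σ*-bijection : ∀ b {Φ} →
    (∀ {x} → Bijection.to b x ≈ 0# → x ≈ 0#) → (∀ {x} → x ≈ 0# → Bijection.to b x ≈ 0#) →
    Φ Preserves _≈_ ⟶ _≡_ → Σ* Φ ≡ Σ* (λ x → Φ (Bijection.to b x))
  Σ*-bijection b {Φ} to≈0⇒≈0 ≈0⇒to≈0 Φ-cong = ≡.trans (ΣFin-bijection b _) (ΣFin-cong q pointwise)
    where
    π = permute b
    pointwise : ∀ i → isNonzero (π ⟨$⟩ʳ i) * Φ (enum (π ⟨$⟩ʳ i)) ≡ isNonzero i * Φ (Bijection.to b (enum i))
    pointwise i = ≡.cong₂ _*_
      (𝟙-cong (λ ≉0 ≈0 → ≉0 (trans (enum-permute b i) (≈0⇒to≈0 ≈0)))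
              (λ ≉0 ≈0 → ≉0 (to≈0⇒≈0 (trans (sym (enum-permute b i)) ≈0)))
              (¬? (enum (π ⟨$⟩ʳ i) ≟ 0#)) (¬? (enum i ≟ 0#)))
      (Φ-cong (enum-permute b i))

  Σ*-scale : ∀ {a} → ¬ a ≈ 0# → ∀ {Φ} → Φ Preserves _≈_ ⟶ _≡_ → Σ* Φ ≡ Σ* (λ x → Φ (a ⊗ x))
  Σ*-scale {a} a≉0 = Σ*-bijection (scaling a a≉0) ax≈0⇒x≈0 (λ x≈0 → trans (*-congˡ x≈0) (zeroʳ a))
    where
    ax≈0⇒x≈0 : ∀ {x} → a ⊗ x ≈ 0# → x ≈ 0#
    ax≈0⇒x≈0 ax≈0 with x*y≈0⇒x≈0⊎y≈0 ax≈0
    ... | inj₁ a≈0 = contradiction a≈0 a≉0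
    ... | inj₂ x≈0 = x≈0

  Σ*-inv : ∀ {Φ} → Φ Preserves _≈_ ⟶ _≡_ → Σ* Φ ≡ Σ* (λ x → Φ (inv x))
  Σ*-inv = Σ*-bijection inversion (λ inv≈0 → trans (sym (inv-involutive _)) (inv-0# inv≈0)) inv-0#

  ΣFin-inverse-δ : ∀ i (h : Fin q → ℕ) →
    ΣFin q (λ j → 𝟙 ((enum i ⊗ enum j) ≟ 1#) * h j) ≡ isNonzero i * h (index (inv (enum i)))
  ΣFin-inverse-δ i h = by-cases (enum i ≟ 0#)
    where
    by-cases : Dec (enum i ≈ 0#) →
      ΣFin q (λ j → 𝟙 ((enum i ⊗ enum j) ≟ 1#) * h j) ≡ 𝟙 (¬? (enum i ≟ 0#)) * h (index (inv (enum i)))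
    by-cases (yes x≈0) = ≡.trans
      (ΣFin-𝟙-none q (λ j → (enum i ⊗ enum j) ≟ 1#) h
        (λ j xy≈1 → 1≉0 (trans (sym xy≈1) (trans (*-congʳ x≈0) (zeroˡ _)))))
      (≡.sym (≡.cong (_* h (index (inv (enum i)))) (𝟙-no (¬? (enum i ≟ 0#)) (λ x≉0 → x≉0 x≈0))))
    by-cases (no x≉0)  = ≡.trans
      (ΣFin-δ q (λ j → (enum i ⊗ enum j) ≟ 1#) h (index (inv (enum i)))
        (λ j xy≈1 → enum-injective (trans (inverse-unique x≉0 xy≈1) (sym (enum-index _))))
        (trans (*-congˡ (enum-index _)) (*-inverseʳ (enum i) x≉0)))
      (≡.sym (≡.trans (≡.cong (_* h (index (inv (enum i)))) (𝟙-yes (¬? (enum i ≟ 0#)) x≉0))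
                     (ℕ.*-identityˡ (h (index (inv (enum i)))))))

  ΣFin-inverse-pairs : ∀ (Φ : Carrier → Carrier → ℕ) → (∀ x → Φ x Preserves _≈_ ⟶ _≡_) →
    ΣFin q (λ i → ΣFin q (λ j → 𝟙 ((enum i ⊗ enum j) ≟ 1#) * Φ (enum i) (enum j)))
    ≡ Σ* (λ x → Φ x (inv x))
  ΣFin-inverse-pairs Φ Φ-cong = ΣFin-cong q (λ i → ≡.trans (ΣFin-inverse-δ i (λ j → Φ (enum i) (enum j)))
    (≡.cong (isNonzero i *_) (Φ-cong (enum i) (enum-index _))))

  Σ*-*ˡ : ∀ k Φ → Σ* (λ x → k * Φ x) ≡ k * Σ* Φ
  Σ*-*ˡ k Φ = ≡.trans (ΣFin-cong q (λ i → ℕ*.x∙yz≈y∙xz (isNonzero i) k (Φ (enum i)))) (ΣFin-*ˡ q k _)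

  ΣFin-Σ*-comm : ∀ n (Φ : Fin n → Carrier → ℕ) →
    ΣFin n (λ i → Σ* (Φ i)) ≡ Σ* (λ x → ΣFin n (λ i → Φ i x))
  ΣFin-Σ*-comm n Φ = ≡.trans (ΣFin-comm n q _) (ΣFin-cong q (λ j → ΣFin-*ˡ n (isNonzero j) _))

  pow≡^ᴿ : ∀ x n → pow x n ≡ x ^ᴿ n
  pow≡^ᴿ x zero    = ≡.refl
  pow≡^ᴿ x (suc n) = ≡.cong (x ⊗_) (pow≡^ᴿ x n)

  ×ᴿ≈nat⊗ : ∀ n x → n ×ᴿ x ≈ nat n ⊗ x
  ×ᴿ≈nat⊗ zero    x = sym (zeroˡ x)
  ×ᴿ≈nat⊗ (suc n) x = begin
    x ⊕ n ×ᴿ x            ≈⟨ +-cong (sym (*-identityˡ x)) (×ᴿ≈nat⊗ n x) ⟩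
    1# ⊗ x ⊕ nat n ⊗ x    ≈⟨ sym (distribʳ x 1# (nat n)) ⟩
    (1# ⊕ nat n) ⊗ x      ∎
    where open ≈-Reasoning

  sum-last : ∀ n (f : Fin (suc n) → Carrier) → (∀ i → toℕ i < n → f i ≈ 0#) →
    sum f ≈ f (fromℕ n)
  sum-last zero    f _     = +-identityʳ _
  sum-last (suc n) f init≈0 = trans (+-congʳ (init≈0 fzero (s≤s z≤n)))
    (trans (+-identityˡ _) (sum-last n (λ i → f (fsuc i)) (λ i i<n → init≈0 (fsuc i) (s≤s i<n))))

  ΣR-cong : ∀ n {f g : ℕ → Carrier} → (∀ r → f r ≈ g r) → ΣR n f ≈ ΣR n g
  ΣR-cong zero    f≈g = refl
  ΣR-cong (suc n) f≈g = +-cong (f≈g n) (ΣR-cong n f≈g)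

  ΣR-zero : ∀ n → ΣR n (λ _ → 0#) ≈ 0#
  ΣR-zero zero    = refl
  ΣR-zero (suc n) = trans (+-identityˡ _) (ΣR-zero n)

  ΣR-distrib-+ : ∀ n (f g : ℕ → Carrier) → ΣR n (λ r → f r ⊕ g r) ≈ ΣR n f ⊕ ΣR n g
  ΣR-distrib-+ zero    f g = sym (+-identityʳ 0#)
  ΣR-distrib-+ (suc n) f g = trans (+-congˡ (ΣR-distrib-+ n f g)) (+-interchange (f n) (g n) _ _)

  ΣR-*ˡ : ∀ n a (f : ℕ → Carrier) → ΣR n (λ r → a ⊗ f r) ≈ a ⊗ ΣR n f
  ΣR-*ˡ zero    a f = sym (zeroʳ a)
  ΣR-*ˡ (suc n) a f = trans (+-congˡ (ΣR-*ˡ n a f)) (sym (distribˡ a (f n) (ΣR n f)))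

  ΣR-shift : ∀ n (f : ℕ → Carrier) → ΣR n (λ r → f (suc r)) ⊕ f 0 ≈ ΣR n f ⊕ f n
  ΣR-shift zero    f = refl
  ΣR-shift (suc n) f = begin
    (f (suc n) ⊕ ΣR n (λ r → f (suc r))) ⊕ f 0 ≈⟨ +-assoc _ _ _ ⟩
    f (suc n) ⊕ (ΣR n (λ r → f (suc r)) ⊕ f 0) ≈⟨ +-congˡ (ΣR-shift n f) ⟩
    f (suc n) ⊕ (ΣR n f ⊕ f n)                  ≈⟨ +-comm _ _ ⟩
    (ΣR n f ⊕ f n) ⊕ f (suc n)                  ≈⟨ +-congʳ (+-comm _ _) ⟩
    (f n ⊕ ΣR n f) ⊕ f (suc n)                  ∎
    where open ≈-Reasoning

  -- Polynomial functions, witnessed in Horner form f y ≈ a + y g y: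
  -- Monic n f says f is monic of degree n, Poly n f that f has degree < n.
  data Monic : ℕ → (Carrier → Carrier) → Set (c ⊔ ℓ) where
    monic₀ : ∀ {f} → (∀ y → f y ≈ 1#) → Monic zero f
    monicₛ : ∀ {n f} a g → Monic n g → (∀ y → f y ≈ a ⊕ y ⊗ g y) → Monic (suc n) f

  data Poly : ℕ → (Carrier → Carrier) → Set (c ⊔ ℓ) where
    poly₀ : ∀ {f} → (∀ y → f y ≈ 0#) → Poly zero f
    polyₛ : ∀ {n f} a g → Poly n g → (∀ y → f y ≈ a ⊕ y ⊗ g y) → Poly (suc n) f

  poly-zero : ∀ n {f} → (∀ y → f y ≈ 0#) → Poly n f
  poly-zero zero    f≈0 = poly₀ f≈0
  poly-zero (suc n) f≈0 = polyₛ 0# (λ _ → 0#) (poly-zero n (λ _ → refl))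
    (λ y → trans (f≈0 y) (sym (trans (+-identityˡ _) (zeroʳ y))))

  poly-≤ : ∀ {m n f} → m ≤ n → Poly m f → Poly n f
  poly-≤ z≤n       (poly₀ f≈0)          = poly-zero _ f≈0
  poly-≤ (s≤s m≤n) (polyₛ a g pg f≈a+yg) = polyₛ a g (poly-≤ m≤n pg) f≈a+yg

  monic⇒poly : ∀ {n f} → Monic n f → Poly (suc n) f
  monic⇒poly (monic₀ f≈1)          = polyₛ 1# (λ _ → 0#) (poly₀ (λ _ → refl))
    (λ y → trans (f≈1 y) (sym (trans (+-congˡ (zeroʳ y)) (+-identityʳ 1#))))
  monic⇒poly (monicₛ a g mg f≈a+yg) = polyₛ a g (monic⇒poly mg) f≈a+yg

  horner-+ : ∀ a a′ y b b′ → (a ⊕ y ⊗ b) ⊕ (a′ ⊕ y ⊗ b′) ≈ (a ⊕ a′) ⊕ y ⊗ (b ⊕ b′)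
  horner-+ = solve 5 (λ a a′ y b b′ → (a :+ y :* b) :+ (a′ :+ y :* b′) := (a :+ a′) :+ y :* (b :+ b′)) refl

  poly-+ : ∀ {n f g} → Poly n f → Poly n g → Poly n (λ y → f y ⊕ g y)
  poly-+ (poly₀ f≈0) (poly₀ g≈0) = poly₀ (λ y → trans (+-cong (f≈0 y) (g≈0 y)) (+-identityˡ 0#))
  poly-+ (polyₛ a f′ pf f≈) (polyₛ b g′ pg g≈) = polyₛ (a ⊕ b) (λ y → f′ y ⊕ g′ y) (poly-+ pf pg)
    (λ y → trans (+-cong (f≈ y) (g≈ y)) (horner-+ a b y (f′ y) (g′ y)))

  monic-+ : ∀ {n f g} → Monic n f → Poly n g → Monic n (λ y → f y ⊕ g y)
  monic-+ (monic₀ f≈1) (poly₀ g≈0) = monic₀ (λ y → trans (+-cong (f≈1 y) (g≈0 y)) (+-identityʳ 1#))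
  monic-+ (monicₛ a f′ mf f≈) (polyₛ b g′ pg g≈) = monicₛ (a ⊕ b) (λ y → f′ y ⊕ g′ y) (monic-+ mf pg)
    (λ y → trans (+-cong (f≈ y) (g≈ y)) (horner-+ a b y (f′ y) (g′ y)))

  monic-pow : ∀ n → Monic n (λ y → pow y n)
  monic-pow zero    = monic₀ (λ _ → refl)
  monic-pow (suc n) = monicₛ 0# (λ y → pow y n) (monic-pow n) (λ y → sym (+-identityˡ _))

  y≈[y-r]+r : ∀ y r → y ≈ (y - r) ⊕ r
  y≈[y-r]+r y r = sym (trans (+-assoc _ _ _) (trans (+-congˡ (-‿inverseˡ r)) (+-identityʳ y)))

  monic-divide : ∀ {n f} → Monic (suc n) f → ∀ r →
    ∃ λ h → Monic n h × (∀ y → f y ≈ (y - r) ⊗ h y ⊕ f r)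
  monic-divide {f = f} (monicₛ a g (monic₀ g≈1) f≈) r = (λ _ → 1#) , monic₀ (λ _ → refl) , λ y → begin
    f y                            ≈⟨ f≈ y ⟩
    a ⊕ y ⊗ g y                    ≈⟨ +-congˡ (*-cong (y≈[y-r]+r y r) (g≈1 y)) ⟩
    a ⊕ ((y - r) ⊕ r) ⊗ 1#
      ≈⟨ solve 3 (λ a d r → a :+ (d :+ r) :* con 1 := d :* con 1 :+ (a :+ r :* con 1)) refl a (y - r) r ⟩
    (y - r) ⊗ 1# ⊕ (a ⊕ r ⊗ 1#)     ≈⟨ +-congˡ (sym (trans (f≈ r) (+-congˡ (*-congˡ (g≈1 r))))) ⟩
    (y - r) ⊗ 1# ⊕ f r              ∎
    where open ≈-Reasoning
  monic-divide {f = f} (monicₛ a g mg@(monicₛ _ _ _ _) f≈) r with monic-divide mg r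
  ... | h , mh , g≈ = (λ y → g r ⊕ y ⊗ h y) , monicₛ (g r) h mh (λ _ → refl) , λ y → begin
    f y                                              ≈⟨ f≈ y ⟩
    a ⊕ y ⊗ g y                                      ≈⟨ +-congˡ (*-cong (y≈[y-r]+r y r) (g≈ y)) ⟩
    a ⊕ ((y - r) ⊕ r) ⊗ ((y - r) ⊗ h y ⊕ g r)
      ≈⟨ solve 5 (λ a d r h g → a :+ (d :+ r) :* (d :* h :+ g) := d :* (g :+ (d :+ r) :* h) :+ (a :+ r :* g))
           refl a (y - r) r (h y) (g r) ⟩
    (y - r) ⊗ (g r ⊕ ((y - r) ⊕ r) ⊗ h y) ⊕ (a ⊕ r ⊗ g r)
      ≈⟨ +-cong (*-congˡ (+-congˡ (*-congʳ (sym (y≈[y-r]+r y r))))) (sym (f≈ r)) ⟩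
    (y - r) ⊗ (g r ⊕ y ⊗ h y) ⊕ f r                  ∎
    where open ≈-Reasoning

  monic-roots : ∀ n {f} → Monic n f → (rs : Fin n → Carrier) → (∀ {i j} → rs i ≈ rs j → i ≡ j) →
    (∀ i → f (rs i) ≈ 0#) → ∀ y → f y ≈ product (λ i → y - rs i)
  monic-roots zero    (monic₀ f≈1) rs rs-inj roots y = f≈1 y
  monic-roots (suc n) {f} mf rs rs-inj roots y with monic-divide mf (rs fzero)
  ... | h , mh , f≈ = begin
    f y                                  ≈⟨ f≈ y ⟩
    (y - rs fzero) ⊗ h y ⊕ f (rs fzero)  ≈⟨ +-congˡ (roots fzero) ⟩
    (y - rs fzero) ⊗ h y ⊕ 0#            ≈⟨ +-identityʳ _ ⟩
    (y - rs fzero) ⊗ h y                 ≈⟨ *-congˡ (monic-roots n mh (λ i → rs (fsuc i))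
                                              (λ e → Fin.suc-injective (rs-inj e)) h-roots y) ⟩
    (y - rs fzero) ⊗ product (λ i → y - rs (fsuc i)) ∎
    where
    open ≈-Reasoning
    h-roots : ∀ i → h (rs (fsuc i)) ≈ 0#
    h-roots i with x*y≈0⇒x≈0⊎y≈0 (trans (sym (+-identityʳ _))
                     (trans (+-congˡ (sym (roots fzero))) (trans (sym (f≈ (rs (fsuc i)))) (roots (fsuc i)))))
    ... | inj₁ ri-r0≈0 = contradiction (rs-inj (x∙y⁻¹≈ε⇒x≈y _ _ ri-r0≈0)) (λ ())
    ... | inj₂ h≈0     = h≈0

  monic-root-among : ∀ n {f} → Monic n f → (rs : Fin n → Carrier) → (∀ {i j} → rs i ≈ rs j → i ≡ j) →
    (∀ i → f (rs i) ≈ 0#) → ∀ {y} → f y ≈ 0# → ∃ λ i → y ≈ rs i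
  monic-root-among n mf rs rs-inj roots {y} fy≈0
    with product≈0⇒ n _ (trans (sym (monic-roots n mf rs rs-inj roots y)) fy≈0)
  ... | i , y-ri≈0 = i , x∙y⁻¹≈ε⇒x≈y _ _ y-ri≈0

module PrimeCharacteristic {c ℓ} (p′ m′ : ℕ) (p-prime : Prime (suc p′))
                           (F : FiniteField c ℓ (suc p′ ^ suc m′)) where

  open import Data.Nat using (_/_)
  open import Data.Nat.DivMod using (m≡m%n+[m/n]*n; m%n<n)
  open import Data.Nat.Combinatorics using (_C_; nCn≡1)
  open import Data.Nat.Divisibility using (divides)
  open import Data.Nat.Coprimality using (coprime-Bézout; prime⇒coprime)
  open import Data.Nat.GCD using (module Bézout)

  p m q : ℕ
  p = suc p′
  m = suc m′
  q = p ^ m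

  open FieldProperties F public

  import Algebra.Properties.CommutativeSemiring.Binomial commutativeSemiring as Binomial
  open import Algebra.Properties.Ring ring using (-‿distribʳ-*)

  1<p : 1 < p
  1<p = nonTrivial⇒n>1 p {{prime⇒nonTrivial p-prime}}

  nat-p≈0 : nat p ≈ 0#
  nat-p≈0 = pow≈0⇒≈0 m (trans (sym (nat-^ p m)) nat-q≈0)

  nat-*p : ∀ k → nat (k * p) ≈ 0#
  nat-*p k = trans (nat-* k p) (trans (*-congˡ nat-p≈0) (zeroʳ _))

  nat-% : ∀ n → nat n ≈ nat (n % p)
  nat-% n = begin
    nat n                           ≡⟨ ≡.cong nat (m≡m%n+[m/n]*n n p) ⟩
    nat (n % p + (n / p) * p)       ≈⟨ nat-+ (n % p) ((n / p) * p) ⟩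
    nat (n % p) ⊕ nat ((n / p) * p) ≈⟨ +-congˡ (nat-*p (n / p)) ⟩
    nat (n % p) ⊕ 0#                ≈⟨ +-identityʳ _ ⟩
    nat (n % p)                     ∎
    where open ≈-Reasoning

  -- A Bézout identity a k = 1 + b p (or its mirror) becomes 0 = 1 in the field.
  nat-nonzero : ∀ {k} → 0 < k → k < p → ¬ nat k ≈ 0#
  nat-nonzero {k@(suc _)} _ k<p nat-k≈0 with coprime-Bézout (prime⇒coprime p-prime k<p)
  ... | Bézout.+- a b eq = 1≉0 (begin
    1#                  ≈⟨ sym (+-identityʳ 1#) ⟩
    1# ⊕ 0#             ≈⟨ +-congˡ (sym (trans (nat-* b k) (trans (*-congˡ nat-k≈0) (zeroʳ _)))) ⟩
    nat (1 + b * k)     ≡⟨ ≡.cong nat eq ⟩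
    nat (a * p)         ≈⟨ nat-*p a ⟩
    0#                  ∎)
    where open ≈-Reasoning
  ... | Bézout.-+ a b eq = 1≉0 (begin
    1#                  ≈⟨ sym (+-identityʳ 1#) ⟩
    1# ⊕ 0#             ≈⟨ +-congˡ (sym (nat-*p a)) ⟩
    nat (1 + a * p)     ≡⟨ ≡.cong nat eq ⟩
    nat (b * k)         ≈⟨ nat-* b k ⟩
    nat b ⊗ nat k       ≈⟨ *-congˡ nat-k≈0 ⟩
    nat b ⊗ 0#          ≈⟨ zeroʳ _ ⟩
    0#                  ∎)
    where open ≈-Reasoning

  nat-distinct : ∀ {i j} → i < j → j < p → ¬ nat i ≈ nat j
  nat-distinct {i} {j} i<j j<p nat-i≈nat-j with ℕ.m≤n⇒∃[o]m+o≡n i<j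
  ... | d , i+1+d≡j = nat-nonzero {suc d} (s≤s z≤n)
    (ℕ.≤-<-trans (≡.subst (suc d ≤_) i+d≡j (ℕ.m≤n+m (suc d) i)) j<p)
    (identityʳ-unique (nat i) _
      (trans (sym (nat-+ i (suc d))) (trans (reflexive (≡.cong nat i+d≡j)) (sym nat-i≈nat-j))))
    where
    i+d≡j : i + suc d ≡ j
    i+d≡j = ≡.trans (ℕ.+-suc i d) i+1+d≡j

  nat-injective : ∀ {i j} → i < p → j < p → nat i ≈ nat j → i ≡ j
  nat-injective {i} {j} i<p j<p nat-i≈nat-j with ℕ.<-cmp i j
  ... | tri≈ _ i≡j _ = i≡j
  ... | tri< i<j _ _ = contradiction nat-i≈nat-j (nat-distinct i<j j<p)
  ... | tri> _ _ j<i = contradiction (sym nat-i≈nat-j) (nat-distinct j<i i<p)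

  𝟙-% : ∀ n {b} → b < p → 𝟙 (n % p ℕ.≟ b) ≡ 𝟙 (nat n ≟ nat b)
  𝟙-% n {b} b<p = 𝟙-cong (λ n%p≡b → trans (nat-% n) (reflexive (≡.cong nat n%p≡b)))
    (λ n≈b → nat-injective (m%n<n n p) b<p (trans (sym (nat-% n)) n≈b))
    (n % p ℕ.≟ b) (nat n ≟ nat b)

  nat-pCk≈0 : ∀ {k} → 0 < k → k < p → nat (p C k) ≈ 0#
  nat-pCk≈0 0<k k<p with p∣pCk p-prime 0<k k<p
  ... | divides t pCk≡t*p = trans (reflexive (≡.cong nat pCk≡t*p)) (nat-*p t)

  -- Only the extreme terms of the binomial expansion survive, since p ∣ p C k for 0 < k < p.
  pow-p-+ : ∀ x y → pow (x ⊕ y) p ≈ pow x p ⊕ pow y p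
  pow-p-+ x y = begin
    pow (x ⊕ y) p                            ≡⟨ pow≡^ᴿ (x ⊕ y) p ⟩
    (x ⊕ y) ^ᴿ p                             ≈⟨ Binomial.theorem p x y ⟩
    term fzero ⊕ sum (λ i → term (fsuc i))   ≈⟨ +-cong first (trans (sum-last p′ _ middle) last) ⟩
    pow y p ⊕ pow x p                        ≈⟨ +-comm _ _ ⟩
    pow x p ⊕ pow y p                        ∎
    where
    open ≈-Reasoning
    term = Binomial.binomialTerm x y p
    first : term fzero ≈ pow y p
    first = begin
      term fzero                   ≈⟨ ×ᴿ≈nat⊗ (p C 0) _ ⟩
      (1# ⊕ 0#) ⊗ (1# ⊗ y ^ᴿ p)    ≈⟨ trans (*-congʳ (+-identityʳ 1#)) (*-identityˡ _) ⟩
      1# ⊗ y ^ᴿ p                  ≈⟨ *-identityˡ _ ⟩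
      y ^ᴿ p                       ≡⟨ ≡.sym (pow≡^ᴿ y p) ⟩
      pow y p                      ∎
    middle : ∀ i → toℕ i < p′ → term (fsuc i) ≈ 0#
    middle i i<p′ = trans (×ᴿ≈nat⊗ (p C suc (toℕ i)) _)
      (trans (*-congʳ (nat-pCk≈0 (s≤s z≤n) (s≤s i<p′))) (zeroˡ _))
    last : term (fsuc (fromℕ p′)) ≈ pow x p
    last = begin
      term (fsuc (fromℕ p′))
        ≈⟨ ×ᴿ≈nat⊗ (p C suc (toℕ (fromℕ p′))) _ ⟩
      nat (p C suc (toℕ (fromℕ p′))) ⊗ (x ^ᴿ suc (toℕ (fromℕ p′)) ⊗ y ^ᴿ (p′ ∸ toℕ (fromℕ p′)))
        ≡⟨ ≡.cong (λ t → nat (p C suc t) ⊗ (x ^ᴿ suc t ⊗ y ^ᴿ (p′ ∸ t))) (Fin.toℕ-fromℕ p′) ⟩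
      nat (p C p) ⊗ (x ^ᴿ p ⊗ y ^ᴿ (p′ ∸ p′))
        ≡⟨ ≡.cong₂ (λ a b → nat a ⊗ (x ^ᴿ p ⊗ y ^ᴿ b)) (nCn≡1 p) (ℕ.n∸n≡0 p′) ⟩
      (1# ⊕ 0#) ⊗ (x ^ᴿ p ⊗ 1#)  ≈⟨ *-cong (+-identityʳ 1#) (*-identityʳ _) ⟩
      1# ⊗ x ^ᴿ p                ≈⟨ *-identityˡ _ ⟩
      x ^ᴿ p                     ≡⟨ ≡.sym (pow≡^ᴿ x p) ⟩
      pow x p                    ∎

  pow-pʳ-+ : ∀ r x y → pow (x ⊕ y) (p ^ r) ≈ pow x (p ^ r) ⊕ pow y (p ^ r)
  pow-pʳ-+ zero    x y = trans (*-identityʳ _) (+-cong (sym (*-identityʳ x)) (sym (*-identityʳ y)))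
  pow-pʳ-+ (suc r) x y = begin
    pow (x ⊕ y) (p * p ^ r)                     ≈⟨ pow-* (x ⊕ y) p (p ^ r) ⟩
    pow (pow (x ⊕ y) p) (p ^ r)                 ≈⟨ pow-cong (p ^ r) (pow-p-+ x y) ⟩
    pow (pow x p ⊕ pow y p) (p ^ r)             ≈⟨ pow-pʳ-+ r _ _ ⟩
    pow (pow x p) (p ^ r) ⊕ pow (pow y p) (p ^ r) ≈⟨ +-cong (sym (pow-* x p (p ^ r))) (sym (pow-* y p (p ^ r))) ⟩
    pow x (p * p ^ r) ⊕ pow y (p * p ^ r)       ∎
    where open ≈-Reasoning

  InPrimeField : Carrier → Set ℓ
  InPrimeField z = pow z p ≈ z

  InPrimeField-pow-pʳ : ∀ {z} → InPrimeField z → ∀ r → pow z (p ^ r) ≈ z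
  InPrimeField-pow-pʳ {z} z∈𝔽ₚ zero    = *-identityʳ z
  InPrimeField-pow-pʳ {z} z∈𝔽ₚ (suc r) =
    trans (pow-* z p (p ^ r)) (trans (pow-cong (p ^ r) z∈𝔽ₚ) (InPrimeField-pow-pʳ z∈𝔽ₚ r))

  InPrimeField-nat : ∀ k → InPrimeField (nat k)
  InPrimeField-nat zero    = zeroˡ _
  InPrimeField-nat (suc k) = trans (pow-p-+ 1# (nat k)) (+-cong (pow-1# p) (InPrimeField-nat k))

  InPrimeField-⊗ : ∀ {a b} → InPrimeField a → InPrimeField b → InPrimeField (a ⊗ b)
  InPrimeField-⊗ {a} {b} a∈𝔽ₚ b∈𝔽ₚ = trans (pow-distrib-⊗ a b p) (*-cong a∈𝔽ₚ b∈𝔽ₚ)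

  InPrimeField-pow : ∀ {a} → InPrimeField a → ∀ n → InPrimeField (pow a n)
  InPrimeField-pow a∈𝔽ₚ zero    = pow-1# p
  InPrimeField-pow a∈𝔽ₚ (suc n) = InPrimeField-⊗ a∈𝔽ₚ (InPrimeField-pow a∈𝔽ₚ n)

  InPrimeField-inv : ∀ {a} → InPrimeField a → InPrimeField (inv a)
  InPrimeField-inv {a} a∈𝔽ₚ = by-cases (a ≟ 0#)
    where
    by-cases : Dec (a ≈ 0#) → InPrimeField (inv a)
    by-cases (yes a≈0) = trans (pow-cong p (inv-0# a≈0)) (trans (zeroˡ _) (sym (inv-0# a≈0)))
    by-cases (no a≉0)  = inverse-unique a≉0 (*-cancelˡ-nonzero a≉0 (begin
      a ⊗ (a ⊗ pow (inv a) p)               ≈⟨ *-cong (sym a∈𝔽ₚ) (*-congʳ (sym a∈𝔽ₚ)) ⟩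
      pow a p ⊗ (pow a p ⊗ pow (inv a) p)   ≈⟨ *-congˡ (sym (pow-distrib-⊗ a (inv a) p)) ⟩
      pow a p ⊗ pow (a ⊗ inv a) p           ≈⟨ *-congˡ (trans (pow-cong p (*-inverseʳ a a≉0)) (pow-1# p)) ⟩
      pow a p ⊗ 1#                          ≈⟨ *-congʳ a∈𝔽ₚ ⟩
      a ⊗ 1#                                ∎))
      where open ≈-Reasoning

  neg-poly : Poly 2 (λ y → - y)
  neg-poly = polyₛ 0# (λ _ → - 1#) (polyₛ (- 1#) (λ _ → 0#) (poly₀ (λ _ → refl))
      (λ y → sym (trans (+-congˡ (zeroʳ y)) (+-identityʳ _))))
    (λ y → sym (trans (+-identityˡ _) (trans (sym (-‿distribʳ-* y 1#)) (-‿cong (*-identityʳ y)))))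

  yᵖ-y-monic : Monic p (λ y → pow y p - y)
  yᵖ-y-monic = monic-+ (monic-pow p) (poly-≤ 1<p neg-poly)

  residue : Fin p → Carrier
  residue i = nat (toℕ i)

  residue-injective : ∀ {i j} → residue i ≈ residue j → i ≡ j
  residue-injective e = Fin.toℕ-injective (nat-injective (Fin.toℕ<n _) (Fin.toℕ<n _) e)

  -- The elements 0, 1, …, p - 1 are p distinct roots of y^p - y.
  abstract
    InPrimeField⇒nat : ∀ {y} → InPrimeField y → ∃ λ k → k < p × y ≈ nat k
    InPrimeField⇒nat {y} y∈𝔽ₚ = toℕ (proj₁ root) , Fin.toℕ<n (proj₁ root) , proj₂ root
      where
      residue-root : ∀ i → pow (residue i) p - residue i ≈ 0#
      residue-root i = trans (+-congʳ (InPrimeField-nat (toℕ i))) (-‿inverseʳ _)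
      root : ∃ λ i → y ≈ residue i
      root = monic-root-among p yᵖ-y-monic residue residue-injective residue-root
        (trans (+-congʳ y∈𝔽ₚ) (-‿inverseʳ y))

  pow-p-ΣR : ∀ n (f : ℕ → Carrier) → pow (ΣR n f) p ≈ ΣR n (λ r → pow (f r) p)
  pow-p-ΣR zero    f = zeroˡ _
  pow-p-ΣR (suc n) f = trans (pow-p-+ (f n) (ΣR n f)) (+-congˡ (pow-p-ΣR n f))

  tr : Carrier → Carrier
  tr = trace F p m

  tr-cong : ∀ {x y} → x ≈ y → tr x ≈ tr y
  tr-cong x≈y = ΣR-cong m (λ r → pow-cong (p ^ r) x≈y)

  tr-+ : ∀ x y → tr (x ⊕ y) ≈ tr x ⊕ tr y
  tr-+ x y = trans (ΣR-cong m (λ r → pow-pʳ-+ r x y)) (ΣR-distrib-+ m _ _)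

  tr-*ˡ : ∀ {a} → InPrimeField a → ∀ x → tr (a ⊗ x) ≈ a ⊗ tr x
  tr-*ˡ {a} a∈𝔽ₚ x = trans
    (ΣR-cong m (λ r → trans (pow-distrib-⊗ a x (p ^ r)) (*-congʳ (InPrimeField-pow-pʳ a∈𝔽ₚ r))))
    (ΣR-*ˡ m a _)

  tr-0# : tr 0# ≈ 0#
  tr-0# = trans (ΣR-cong m (InPrimeField-pow-pʳ (InPrimeField-nat 0))) (ΣR-zero m)

  -- Raising to the p-th power shifts the Frobenius orbit x, x^p, …, x^(p^(m-1)) by one,
  -- and x^(p^m) = x closes it up.
  InPrimeField-tr : ∀ x → InPrimeField (tr x)
  InPrimeField-tr x = +-cancelʳ x _ _ (begin
    pow (tr x) p ⊕ x                       ≈⟨ +-cong (pow-p-ΣR m orbit) (sym (*-identityʳ x)) ⟩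
    ΣR m (λ r → pow (orbit r) p) ⊕ orbit 0 ≈⟨ +-congʳ (ΣR-cong m orbit-step) ⟩
    ΣR m (λ r → orbit (suc r)) ⊕ orbit 0   ≈⟨ ΣR-shift m orbit ⟩
    ΣR m orbit ⊕ orbit m                   ≈⟨ +-congˡ (x^q≈x x) ⟩
    tr x ⊕ x                               ∎)
    where
    open ≈-Reasoning
    orbit : ℕ → Carrier
    orbit r = pow x (p ^ r)
    orbit-step : ∀ r → pow (orbit r) p ≈ orbit (suc r)
    orbit-step r = trans (sym (pow-* x (p ^ r) p)) (reflexive (≡.cong (pow x) (ℕ.*-comm (p ^ r) p)))

  tr-monic : Monic (p ^ m′) tr
  tr-monic = monic-+ (monic-pow (p ^ m′)) (lower-terms m′ ℕ.≤-refl)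
    where
    lower-terms : ∀ k → k ≤ m′ → Poly (p ^ m′) (λ y → ΣR k (λ r → pow y (p ^ r)))
    lower-terms zero    _    = poly-zero _ (λ _ → refl)
    lower-terms (suc k) k<m′ = poly-+ (poly-≤ (ℕ.^-monoʳ-< p 1<p k<m′) (monic⇒poly (monic-pow (p ^ k))))
                                      (lower-terms k (ℕ.<⇒≤ k<m′))

  -- tr has degree p^(m-1) < q, so it cannot vanish on all of the field.
  tr-nonvanishing : ∃ λ x → ¬ tr x ≈ 0#
  tr-nonvanishing with Fin.any? (λ i → ¬? (tr (enum i) ≟ 0#))
  ... | yes (i , tr≉0) = enum i , tr≉0
  ... | no ¬∃           = contradiction (≡.sym d≡i) (ℕ.<⇒≢ (Fin.toℕ<n i))
    where
    d = p ^ m′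
    d<q : d < q
    d<q = ℕ.^-monoʳ-< p 1<p (ℕ.n<1+n m′)
    tr-vanishes : ∀ x → tr x ≈ 0#
    tr-vanishes x with tr x ≟ 0#
    ... | yes tr≈0 = tr≈0
    ... | no tr≉0  = contradiction (index x , λ tr≈0 → tr≉0 (trans (tr-cong (sym (enum-index x))) tr≈0)) ¬∃
    lower : Fin d → Carrier
    lower i = enum (inject≤ i (ℕ.<⇒≤ d<q))
    lower-injective : ∀ {i j} → lower i ≈ lower j → i ≡ j
    lower-injective e = Fin.inject≤-injective _ _ _ _ (enum-injective e)
    root : ∃ λ i → enum (fromℕ< d<q) ≈ lower i
    root = monic-root-among d tr-monic lower lower-injective (λ i → tr-vanishes _) (tr-vanishes _)
    i = proj₁ root
    d≡i : d ≡ toℕ i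
    d≡i = ≡.trans (≡.sym (Fin.toℕ-fromℕ< d<q))
            (≡.trans (≡.cong toℕ (enum-injective (proj₂ root))) (Fin.toℕ-inject≤ i _))

  tr-takes-value-1# : ∃ λ x → tr x ≈ 1#
  tr-takes-value-1# = inv t ⊗ x , trans (tr-*ˡ (InPrimeField-inv (InPrimeField-tr x)) x) (*-inverseˡ t t≉0)
    where
    x = proj₁ tr-nonvanishing
    t = tr x
    t≉0 = proj₂ tr-nonvanishing

  unit : Fin p′ → Carrier
  unit k = residue (fsuc k)

  unit-injective : ∀ {k l} → unit k ≈ unit l → k ≡ l
  unit-injective e = Fin.suc-injective (residue-injective e)

  unit-nonzero : ∀ k → ¬ unit k ≈ 0#
  unit-nonzero k = nat-nonzero (s≤s z≤n) (s≤s (Fin.toℕ<n k))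

  InPrimeField-unit : ∀ k → InPrimeField (unit k)
  InPrimeField-unit k = InPrimeField-nat (suc (toℕ k))

  residue-of : ∀ {z} → InPrimeField z → Fin p
  residue-of z∈𝔽ₚ = fromℕ< (proj₁ (proj₂ (InPrimeField⇒nat z∈𝔽ₚ)))

  residue-residue-of : ∀ {z} (z∈𝔽ₚ : InPrimeField z) → residue (residue-of z∈𝔽ₚ) ≈ z
  residue-residue-of z∈𝔽ₚ = trans (reflexive (≡.cong nat (Fin.toℕ-fromℕ< k<p))) (sym z≈k)
    where
    k<p = proj₁ (proj₂ (InPrimeField⇒nat z∈𝔽ₚ))
    z≈k = proj₂ (proj₂ (InPrimeField⇒nat z∈𝔽ₚ))

  unit-of : ∀ {z} → InPrimeField z → ¬ z ≈ 0# → ∃ λ k → unit k ≈ z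
  unit-of z∈𝔽ₚ z≉0 with residue-of z∈𝔽ₚ | residue-residue-of z∈𝔽ₚ
  ... | fzero  | 0≈z = contradiction (sym 0≈z) z≉0
  ... | fsuc k | k≈z = k , k≈z

  ΣFin-residue-expand : ∀ {z} → InPrimeField z → (H : Carrier → ℕ) → H Preserves _≈_ ⟶ _≡_ →
    ΣFin p (λ i → 𝟙 (z ≟ residue i) * H (residue i)) ≡ H z
  ΣFin-residue-expand z∈𝔽ₚ H H-cong = ≡.trans
    (ΣFin-δ p (λ i → _ ≟ residue i) (λ i → H (residue i)) (residue-of z∈𝔽ₚ)
      (λ i z≈i → residue-injective (trans (sym z≈i) (sym (residue-residue-of z∈𝔽ₚ))))
      (sym (residue-residue-of z∈𝔽ₚ)))
    (H-cong (residue-residue-of z∈𝔽ₚ))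

  ΣFin-unit-expand : ∀ {z} → InPrimeField z → ¬ z ≈ 0# → (H : Carrier → ℕ) → H Preserves _≈_ ⟶ _≡_ →
    ΣFin p′ (λ k → 𝟙 (unit k ≟ z) * H (unit k)) ≡ H z
  ΣFin-unit-expand z∈𝔽ₚ z≉0 H H-cong with unit-of z∈𝔽ₚ z≉0
  ... | k , k≈z = ≡.trans
    (ΣFin-δ p′ (λ l → unit l ≟ _) (λ l → H (unit l)) k
      (λ l l≈z → unit-injective (trans l≈z (sym k≈z))) k≈z)
    (H-cong k≈z)

  ΣFin-unit-δ₁ : ∀ {z} → InPrimeField z → ¬ z ≈ 0# → ΣFin p′ (λ k → 𝟙 (unit k ≟ z)) ≡ 1
  ΣFin-unit-δ₁ z∈𝔽ₚ z≉0 = ≡.trans (ΣFin-cong p′ (λ k → ≡.sym (ℕ.*-identityʳ _)))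
    (ΣFin-unit-expand z∈𝔽ₚ z≉0 (λ _ → 1) (λ _ → ≡.refl))

  unit-times : ∀ {a} → InPrimeField a → ¬ a ≈ 0# → Fin p′ → Fin p′
  unit-times a∈𝔽ₚ a≉0 k =
    proj₁ (unit-of (InPrimeField-⊗ a∈𝔽ₚ (InPrimeField-unit k)) (*-nonzero a≉0 (unit-nonzero k)))

  unit-unit-times : ∀ {a} (a∈𝔽ₚ : InPrimeField a) (a≉0 : ¬ a ≈ 0#) k →
    unit (unit-times a∈𝔽ₚ a≉0 k) ≈ a ⊗ unit k
  unit-unit-times a∈𝔽ₚ a≉0 k =
    proj₂ (unit-of (InPrimeField-⊗ a∈𝔽ₚ (InPrimeField-unit k)) (*-nonzero a≉0 (unit-nonzero k)))

  unit-scaling : ∀ {w} → InPrimeField w → ¬ w ≈ 0# → Permutation p′ p′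
  unit-scaling {w} w∈𝔽ₚ w≉0 = permutation (unit-times w∈𝔽ₚ w≉0) (unit-times w⁻¹∈𝔽ₚ w⁻¹≉0)
    (λ k → unit-injective (trans (unit-unit-times w∈𝔽ₚ w≉0 (unit-times w⁻¹∈𝔽ₚ w⁻¹≉0 k))
             (trans (*-congˡ (unit-unit-times w⁻¹∈𝔽ₚ w⁻¹≉0 k)) (*-inv-cancelˡ w≉0 (unit k)))))
    (λ k → unit-injective (trans (unit-unit-times w⁻¹∈𝔽ₚ w⁻¹≉0 (unit-times w∈𝔽ₚ w≉0 k))
             (trans (*-congˡ (unit-unit-times w∈𝔽ₚ w≉0 k)) (inv-*-cancelˡ w≉0 (unit k)))))
    where
    w⁻¹∈𝔽ₚ = InPrimeField-inv w∈𝔽ₚ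
    w⁻¹≉0 = inv-nonzero w≉0

  ΣFin-units-reindex : ∀ (f : Fin p′ → Carrier) → (∀ l → InPrimeField (f l)) → (∀ l → ¬ f l ≈ 0#) →
    (∀ {l l′} → f l ≈ f l′ → l ≡ l′) → (H : Carrier → ℕ) → H Preserves _≈_ ⟶ _≡_ →
    ΣFin p′ (λ l → H (f l)) ≡ ΣFin p′ (λ c → H (unit c))
  ΣFin-units-reindex f f∈𝔽ₚ f≉0 f-injective H H-cong = ≡.sym (begin
    ΣFin p′ (λ c → H (unit c))
      ≡⟨ ΣFin-cong p′ (λ c → ≡.sym (≡.trans (≡.cong (_* H (unit c)) (hits≡1 c)) (ℕ.+-identityʳ _))) ⟩
    ΣFin p′ (λ c → hits c * H (unit c))
      ≡⟨ ΣFin-cong p′ (λ c → ≡.sym (ΣFin-*ʳ p′ (H (unit c)) (λ l → 𝟙 (unit c ≟ f l)))) ⟩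
    ΣFin p′ (λ c → ΣFin p′ (λ l → 𝟙 (unit c ≟ f l) * H (unit c)))
      ≡⟨ ΣFin-cong p′ (λ c → ΣFin-cong p′ (λ l → 𝟙-transport (unit c) (f l))) ⟩
    ΣFin p′ (λ c → ΣFin p′ (λ l → 𝟙 (unit c ≟ f l) * H (f l)))
      ≡⟨ ΣFin-comm p′ p′ _ ⟩
    ΣFin p′ (λ l → ΣFin p′ (λ c → 𝟙 (unit c ≟ f l) * H (f l)))
      ≡⟨ ΣFin-cong p′ (λ l → ≡.trans (ΣFin-*ʳ p′ (H (f l)) _)
           (≡.trans (≡.cong (_* H (f l)) (ΣFin-unit-δ₁ (f∈𝔽ₚ l) (f≉0 l))) (ℕ.+-identityʳ _))) ⟩
    ΣFin p′ (λ l → H (f l)) ∎)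
    where
    open ≡.≡-Reasoning
    hits : Fin p′ → ℕ
    hits c = ΣFin p′ (λ l → 𝟙 (unit c ≟ f l))
    hits≡1 : ∀ c → hits c ≡ 1
    hits≡1 = ΣFin≡n⇒≡1 p′ hits
      (λ c → ΣFin-𝟙≤1 p′ (λ l → unit c ≟ f l) (λ l l′ c≈l c≈l′ → f-injective (trans (sym c≈l) c≈l′)))
      (≡.trans (ΣFin-comm p′ p′ _)
        (≡.trans (ΣFin-cong p′ (λ l → ΣFin-unit-δ₁ (f∈𝔽ₚ l) (f≉0 l))) (ΣFin-one p′)))
    𝟙-transport : ∀ a b → 𝟙 (a ≟ b) * H a ≡ 𝟙 (a ≟ b) * H b
    𝟙-transport a b with a ≟ b
    ... | yes a≈b = ≡.cong (1 *_) (H-cong a≈b)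
    ... | no _    = ≡.refl

module TraceCounts {c ℓ} (p′ m′ : ℕ) (p-prime : Prime (suc p′))
                   (F : FiniteField c ℓ (suc p′ ^ suc m′)) where

  open PrimeCharacteristic p′ m′ p-prime F public

  traceIndicator : Carrier → Carrier → Carrier → ℕ
  traceIndicator a b x = 𝟙 (tr x ≟ a) * 𝟙 (tr (inv x) ≟ b)

  traceIndicator-cong : ∀ a b → traceIndicator a b Preserves _≈_ ⟶ _≡_
  traceIndicator-cong a b x≈y = ≡.cong₂ _*_ (𝟙-≈ (tr-cong x≈y) refl) (𝟙-≈ (tr-cong (inv-cong x≈y)) refl)

  traceCount : Carrier → Carrier → ℕ
  traceCount a b = Σ* (traceIndicator a b)

  traceCount-cong : ∀ {a a′ b b′} → a ≈ a′ → b ≈ b′ → traceCount a b ≡ traceCount a′ b′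
  traceCount-cong {a} {a′} {b} {b′} a≈a′ b≈b′ = Σ*-cong {traceIndicator a b} {traceIndicator a′ b′}
    (λ x _ → ≡.cong₂ _*_ (𝟙-≈ refl a≈a′) (𝟙-≈ refl b≈b′))

  traceCount-comm : ∀ a b → traceCount a b ≡ traceCount b a
  traceCount-comm a b = ≡.trans (Σ*-inv (traceIndicator-cong a b))
    (Σ*-cong {λ x → traceIndicator a b (inv x)} {traceIndicator b a}
      (λ x _ → ≡.trans (ℕ.*-comm (𝟙 (tr (inv x) ≟ a)) (𝟙 (tr (inv (inv x)) ≟ b)))
                 (≡.cong (_* 𝟙 (tr (inv x) ≟ a)) (𝟙-≈ (tr-cong (inv-involutive x)) refl))))

  -- Substituting x ↦ l x multiplies tr x by l and tr x⁻¹ by l⁻¹, as tr is 𝔽ₚ-linear.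
  traceCount-scale : ∀ {l} → InPrimeField l → ¬ l ≈ 0# → ∀ a b →
    traceCount (l ⊗ a) (inv l ⊗ b) ≡ traceCount a b
  traceCount-scale {l} l∈𝔽ₚ l≉0 a b = ≡.trans (Σ*-scale l≉0 (traceIndicator-cong (l ⊗ a) (inv l ⊗ b)))
    (Σ*-cong {λ x → traceIndicator (l ⊗ a) (inv l ⊗ b) (l ⊗ x)} {traceIndicator a b} pointwise)
    where
    pointwise : ∀ x → ¬ x ≈ 0# → traceIndicator (l ⊗ a) (inv l ⊗ b) (l ⊗ x) ≡ traceIndicator a b x
    pointwise x x≉0 = ≡.cong₂ _*_
      (≡.trans (𝟙-≈ (tr-*ˡ l∈𝔽ₚ x) refl) (𝟙-*-cancelˡ l≉0))
      (≡.trans (𝟙-≈ (trans (tr-cong (inv-distrib-⊗ l≉0 x≉0)) (tr-*ˡ (InPrimeField-inv l∈𝔽ₚ) (inv x))) refl)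
               (𝟙-*-cancelˡ (inv-nonzero l≉0)))

  Σ*-by-traces : ∀ (Ψ : Carrier → Carrier → ℕ) → Ψ Preserves₂ _≈_ ⟶ _≈_ ⟶ _≡_ →
    Σ* (λ x → Ψ (tr x) (tr (inv x))) ≡
    ΣFin p (λ i → ΣFin p (λ j → Ψ (residue i) (residue j) * traceCount (residue i) (residue j)))
  Σ*-by-traces Ψ Ψ-cong = ≡.sym (begin
    ΣFin p (λ i → ΣFin p (λ j → Ψ (residue i) (residue j) * traceCount (residue i) (residue j)))
      ≡⟨ ΣFin-cong p (λ i → ΣFin-cong p (λ j →
           ≡.sym (Σ*-*ˡ (Ψ (residue i) (residue j)) (traceIndicator (residue i) (residue j))))) ⟩
    ΣFin p (λ i → ΣFin p (λ j → Σ* (term i j)))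
      ≡⟨ ΣFin-cong p (λ i → ΣFin-Σ*-comm p (term i)) ⟩
    ΣFin p (λ i → Σ* (λ x → ΣFin p (λ j → term i j x)))
      ≡⟨ ΣFin-Σ*-comm p (λ i x → ΣFin p (λ j → term i j x)) ⟩
    Σ* (λ x → ΣFin p (λ i → ΣFin p (λ j → term i j x)))
      ≡⟨ Σ*-cong {λ x → ΣFin p (λ i → ΣFin p (λ j → term i j x))} (λ x _ → sift x) ⟩
    Σ* (λ x → Ψ (tr x) (tr (inv x))) ∎)
    where
    open ≡.≡-Reasoning
    term : Fin p → Fin p → Carrier → ℕ
    term i j x = Ψ (residue i) (residue j) * traceIndicator (residue i) (residue j) x
    sift : ∀ x → ΣFin p (λ i → ΣFin p (λ j → Ψ (residue i) (residue j) * traceIndicator (residue i) (residue j) x))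
                 ≡ Ψ (tr x) (tr (inv x))
    sift x = begin
      ΣFin p (λ i → ΣFin p (λ j → P i j * (A i * B j)))
        ≡⟨ ΣFin-cong p (λ i → ΣFin-cong p (λ j →
             ≡.trans (ℕ*.x∙yz≈y∙xz (P i j) (A i) (B j)) (≡.cong (A i *_) (ℕ.*-comm (P i j) (B j))))) ⟩
      ΣFin p (λ i → ΣFin p (λ j → A i * (B j * P i j)))
        ≡⟨ ΣFin-cong p (λ i → ΣFin-*ˡ p (A i) (λ j → B j * P i j)) ⟩
      ΣFin p (λ i → A i * ΣFin p (λ j → B j * P i j))
        ≡⟨ ΣFin-cong p (λ i → ≡.cong (A i *_)
             (ΣFin-residue-expand (InPrimeField-tr (inv x)) (Ψ (residue i)) (Ψ-cong refl))) ⟩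
      ΣFin p (λ i → A i * Ψ (residue i) (tr (inv x)))
        ≡⟨ ΣFin-residue-expand (InPrimeField-tr x) (λ a → Ψ a (tr (inv x))) (λ a≈a′ → Ψ-cong a≈a′ refl) ⟩
      Ψ (tr x) (tr (inv x)) ∎
      where
      A B : Fin p → ℕ
      A i = 𝟙 (tr x ≟ residue i)
      B j = 𝟙 (tr (inv x) ≟ residue j)
      P : Fin p → Fin p → ℕ
      P i j = Ψ (residue i) (residue j)

  T₀₀ T₀₁ : ℕ
  T₀₀ = traceCount 0# 0#
  T₀₁ = traceCount 0# 1#

  T₁ : Carrier → ℕ
  T₁ = traceCount 1#

  traceCount-0-unit : ∀ k → traceCount 0# (unit k) ≡ T₀₁
  traceCount-0-unit k = ≡.trans (≡.sym (traceCount-scale (InPrimeField-unit k) (unit-nonzero k) 0# (unit k)))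
    (traceCount-cong (zeroʳ (unit k)) (*-inverseˡ (unit k) (unit-nonzero k)))

  traceCount-unit-0 : ∀ k → traceCount (unit k) 0# ≡ T₀₁
  traceCount-unit-0 k = ≡.trans (traceCount-comm (unit k) 0#) (traceCount-0-unit k)

  traceCount-units : ∀ k l → traceCount (unit k) (unit l) ≡ T₁ (unit k ⊗ unit l)
  traceCount-units k l = ≡.trans
    (≡.sym (traceCount-scale (InPrimeField-inv (InPrimeField-unit k)) (inv-nonzero (unit-nonzero k)) (unit k) (unit l)))
    (traceCount-cong (*-inverseˡ (unit k) (unit-nonzero k)) (*-congʳ (inv-involutive (unit k))))

  ΣFin-units-traceCount : ∀ (Ψ : Carrier → Carrier → ℕ) → Ψ Preserves₂ _≈_ ⟶ _≈_ ⟶ _≡_ →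
    ΣFin p′ (λ k → ΣFin p′ (λ l → Ψ (unit k) (unit l) * traceCount (unit k) (unit l)))
    ≡ ΣFin p′ (λ c → T₁ (unit c) * ΣFin p′ (λ k → Ψ (unit k) (inv (unit k) ⊗ unit c)))
  ΣFin-units-traceCount Ψ Ψ-cong = begin
    ΣFin p′ (λ k → ΣFin p′ (λ l → Ψ (unit k) (unit l) * traceCount (unit k) (unit l)))
      ≡⟨ ΣFin-cong p′ (λ k → ≡.trans (ΣFin-permute p′ (ρ k) _) (ΣFin-cong p′ (reindex k))) ⟩
    ΣFin p′ (λ k → ΣFin p′ (λ c → Ψ (unit k) (inv (unit k) ⊗ unit c) * T₁ (unit c)))
      ≡⟨ ΣFin-comm p′ p′ _ ⟩
    ΣFin p′ (λ c → ΣFin p′ (λ k → Ψ (unit k) (inv (unit k) ⊗ unit c) * T₁ (unit c)))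
      ≡⟨ ΣFin-cong p′ (λ c → ≡.trans (ΣFin-*ʳ p′ (T₁ (unit c)) _) (ℕ.*-comm _ (T₁ (unit c)))) ⟩
    ΣFin p′ (λ c → T₁ (unit c) * ΣFin p′ (λ k → Ψ (unit k) (inv (unit k) ⊗ unit c))) ∎
    where
    open ≡.≡-Reasoning
    ρ : Fin p′ → Permutation p′ p′
    ρ k = unit-scaling (InPrimeField-inv (InPrimeField-unit k)) (inv-nonzero (unit-nonzero k))
    ρ-spec : ∀ k c → unit (ρ k ⟨$⟩ʳ c) ≈ inv (unit k) ⊗ unit c
    ρ-spec k c = unit-unit-times (InPrimeField-inv (InPrimeField-unit k)) (inv-nonzero (unit-nonzero k)) c
    reindex : ∀ k c → Ψ (unit k) (unit (ρ k ⟨$⟩ʳ c)) * traceCount (unit k) (unit (ρ k ⟨$⟩ʳ c))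
                      ≡ Ψ (unit k) (inv (unit k) ⊗ unit c) * T₁ (unit c)
    reindex k c = ≡.cong₂ _*_ (Ψ-cong refl (ρ-spec k c))
      (≡.trans (traceCount-units k (ρ k ⟨$⟩ʳ c)) (traceCount-cong refl
        (trans (*-congˡ (ρ-spec k c)) (*-inv-cancelˡ (unit-nonzero k) (unit c)))))

  -- Split 𝔽ₚ² into (0,0), the axes and (𝔽ₚ^*)², using the symmetries of traceCount on each part.
  ΣFin-residues-traceCount : ∀ (Ψ : Carrier → Carrier → ℕ) → Ψ Preserves₂ _≈_ ⟶ _≈_ ⟶ _≡_ →
    ΣFin p (λ i → ΣFin p (λ j → Ψ (residue i) (residue j) * traceCount (residue i) (residue j)))
    ≡ Ψ 0# 0# * T₀₀ + (ΣFin p′ (λ k → Ψ 0# (unit k)) + ΣFin p′ (λ k → Ψ (unit k) 0#)) * T₀₁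
      + ΣFin p′ (λ c → T₁ (unit c) * ΣFin p′ (λ k → Ψ (unit k) (inv (unit k) ⊗ unit c)))
  ΣFin-residues-traceCount Ψ Ψ-cong = begin
    (g fzero fzero + row) + ΣFin p′ (λ k → g (fsuc k) fzero + ΣFin p′ (λ l → g (fsuc k) (fsuc l)))
      ≡⟨ ≡.cong (g fzero fzero + row +_)
           (ΣFin-distrib-+ p′ (λ k → g (fsuc k) fzero) (λ k → ΣFin p′ (λ l → g (fsuc k) (fsuc l)))) ⟩
    (g fzero fzero + row) + (column + units)
      ≡⟨ ≡.sym (ℕ.+-assoc (g fzero fzero + row) column units) ⟩
    ((g fzero fzero + row) + column) + units
      ≡⟨ ≡.cong (_+ units) (ℕ.+-assoc (g fzero fzero) row column) ⟩
    (g fzero fzero + (row + column)) + units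
      ≡⟨ ≡.cong₂ (λ a b → (g fzero fzero + a) + b) axes (ΣFin-units-traceCount Ψ Ψ-cong) ⟩
    Ψ 0# 0# * T₀₀ + (ΣFin p′ (λ k → Ψ 0# (unit k)) + ΣFin p′ (λ k → Ψ (unit k) 0#)) * T₀₁
      + ΣFin p′ (λ c → T₁ (unit c) * ΣFin p′ (λ k → Ψ (unit k) (inv (unit k) ⊗ unit c))) ∎
    where
    open ≡.≡-Reasoning
    g : Fin p → Fin p → ℕ
    g i j = Ψ (residue i) (residue j) * traceCount (residue i) (residue j)
    row column units : ℕ
    row    = ΣFin p′ (λ l → g fzero (fsuc l))
    column = ΣFin p′ (λ k → g (fsuc k) fzero)
    units  = ΣFin p′ (λ k → ΣFin p′ (λ l → g (fsuc k) (fsuc l)))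
    axes : row + column ≡ (ΣFin p′ (λ k → Ψ 0# (unit k)) + ΣFin p′ (λ k → Ψ (unit k) 0#)) * T₀₁
    axes = ≡.trans
      (≡.cong₂ _+_
        (≡.trans (ΣFin-cong p′ (λ k → ≡.cong (Ψ 0# (unit k) *_) (traceCount-0-unit k))) (ΣFin-*ʳ p′ T₀₁ _))
        (≡.trans (ΣFin-cong p′ (λ k → ≡.cong (Ψ (unit k) 0# *_) (traceCount-unit-0 k))) (ΣFin-*ʳ p′ T₀₁ _)))
      (≡.sym (ℕ.*-distribʳ-+ T₀₁ (ΣFin p′ (λ k → Ψ 0# (unit k))) _))

  Σ*-traces : ∀ (Ψ : Carrier → Carrier → ℕ) → Ψ Preserves₂ _≈_ ⟶ _≈_ ⟶ _≡_ →
    Σ* (λ x → Ψ (tr x) (tr (inv x)))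
    ≡ Ψ 0# 0# * T₀₀ + (ΣFin p′ (λ k → Ψ 0# (unit k)) + ΣFin p′ (λ k → Ψ (unit k) 0#)) * T₀₁
      + ΣFin p′ (λ c → T₁ (unit c) * ΣFin p′ (λ k → Ψ (unit k) (inv (unit k) ⊗ unit c)))
  Σ*-traces Ψ Ψ-cong = ≡.trans (Σ*-by-traces Ψ Ψ-cong) (ΣFin-residues-traceCount Ψ Ψ-cong)

  S : ℕ
  S = ΣFin p′ (λ c → T₁ (unit c))

  nonzero-count-by-traces : ΣFin q isNonzero ≡ T₀₀ + (p′ + p′) * T₀₁ + S * p′
  nonzero-count-by-traces = begin
    ΣFin q isNonzero
      ≡⟨ ΣFin-cong q (λ i → ≡.sym (ℕ.*-identityʳ (isNonzero i))) ⟩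
    Σ* (λ _ → 1)
      ≡⟨ Σ*-traces (λ _ _ → 1) (λ _ _ → ≡.refl) ⟩
    1 * T₀₀ + (ΣFin p′ (λ _ → 1) + ΣFin p′ (λ _ → 1)) * T₀₁
      + ΣFin p′ (λ c → T₁ (unit c) * ΣFin p′ (λ _ → 1))
      ≡⟨ ≡.cong₂ _+_ (≡.cong₂ _+_ (ℕ.*-identityˡ T₀₀) (≡.cong (λ n → (n + n) * T₀₁) (ΣFin-one p′)))
                     (≡.trans (ΣFin-cong p′ (λ c → ≡.cong (T₁ (unit c) *_) (ΣFin-one p′))) (ΣFin-*ʳ p′ p′ _)) ⟩
    T₀₀ + (p′ + p′) * T₀₁ + S * p′ ∎
    where open ≡.≡-Reasoning

  traceFiber : Carrier → ℕ
  traceFiber b = Σ* (λ x → 𝟙 (tr x ≟ b))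

  traceFiber-0# : traceFiber 0# ≡ T₀₀ + p′ * T₀₁
  traceFiber-0# = begin
    traceFiber 0#
      ≡⟨ Σ*-traces (λ a _ → 𝟙 (a ≟ 0#)) (λ a≈a′ _ → 𝟙-≈ a≈a′ refl) ⟩
    𝟙 (0# ≟ 0#) * T₀₀ + (ΣFin p′ (λ _ → 𝟙 (0# ≟ 0#)) + ΣFin p′ (λ k → 𝟙 (unit k ≟ 0#))) * T₀₁
      + ΣFin p′ (λ c → T₁ (unit c) * ΣFin p′ (λ k → 𝟙 (unit k ≟ 0#)))
      ≡⟨ ≡.cong₂ _+_ (≡.cong₂ _+_ (≡.cong (_* T₀₀) 0≟0) (≡.cong (_* T₀₁) (≡.cong₂ _+_
           (≡.trans (ΣFin-cong p′ (λ _ → 0≟0)) (ΣFin-one p′)) units≟0)))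
           (≡.trans (ΣFin-cong p′ (λ c → ≡.trans (≡.cong (T₁ (unit c) *_) units≟0) (ℕ.*-zeroʳ (T₁ (unit c)))))
                    (ΣFin-zero p′)) ⟩
    1 * T₀₀ + (p′ + 0) * T₀₁ + 0
      ≡⟨ ≡.trans (ℕ.+-identityʳ _) (≡.cong₂ _+_ (ℕ.*-identityˡ T₀₀) (≡.cong (_* T₀₁) (ℕ.+-identityʳ p′))) ⟩
    T₀₀ + p′ * T₀₁ ∎
    where
    open ≡.≡-Reasoning
    0≟0 : 𝟙 (0# ≟ 0#) ≡ 1
    0≟0 = 𝟙-yes (0# ≟ 0#) refl
    units≟0 : ΣFin p′ (λ k → 𝟙 (unit k ≟ 0#)) ≡ 0
    units≟0 = ≡.trans (ΣFin-cong p′ (λ k → 𝟙-no (unit k ≟ 0#) (unit-nonzero k))) (ΣFin-zero p′)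

  traceFiber-1# : traceFiber 1# ≡ T₀₁ + S
  traceFiber-1# = begin
    traceFiber 1#
      ≡⟨ Σ*-traces (λ a _ → 𝟙 (a ≟ 1#)) (λ a≈a′ _ → 𝟙-≈ a≈a′ refl) ⟩
    𝟙 (0# ≟ 1#) * T₀₀ + (ΣFin p′ (λ _ → 𝟙 (0# ≟ 1#)) + ΣFin p′ (λ k → 𝟙 (unit k ≟ 1#))) * T₀₁
      + ΣFin p′ (λ c → T₁ (unit c) * ΣFin p′ (λ k → 𝟙 (unit k ≟ 1#)))
      ≡⟨ ≡.cong₂ _+_ (≡.cong₂ _+_ (≡.cong (_* T₀₀) 0≟1) (≡.cong (_* T₀₁) (≡.cong₂ _+_
           (≡.trans (ΣFin-cong p′ (λ _ → 0≟1)) (ΣFin-zero p′)) units≟1)))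
           (ΣFin-cong p′ (λ c → ≡.trans (≡.cong (T₁ (unit c) *_) units≟1) (ℕ.*-identityʳ (T₁ (unit c))))) ⟩
    0 * T₀₀ + (0 + 1) * T₀₁ + S
      ≡⟨ ≡.cong (_+ S) (ℕ.+-identityʳ T₀₁) ⟩
    T₀₁ + S ∎
    where
    open ≡.≡-Reasoning
    0≟1 : 𝟙 (0# ≟ 1#) ≡ 0
    0≟1 = 𝟙-no (0# ≟ 1#) (λ 0≈1 → 1≉0 (sym 0≈1))
    units≟1 : ΣFin p′ (λ k → 𝟙 (unit k ≟ 1#)) ≡ 1
    units≟1 = ΣFin-unit-δ₁ (pow-1# p) 1≉0

  -- Translation by some x₀ with tr x₀ = 1 carries the trace-0 elements onto the trace-1 elements;
  -- of these, only the trace-0 ones include x = 0.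
  traceFiber-balanced : traceFiber 0# + 1 ≡ traceFiber 1#
  traceFiber-balanced = begin
    traceFiber 0# + 1                        ≡⟨ ≡.cong (traceFiber 0# +_) (≡.sym (𝟙-yes (tr0 ≟ 0#) tr0≈0)) ⟩
    traceFiber 0# + 𝟙 (tr0 ≟ 0#)             ≡⟨ ≡.sym (ΣFin-split-zero (fiber 0#)) ⟩
    ΣFin q (fiber 0#)                        ≡⟨ ΣFin-cong q (λ i → ≡.sym (translate i)) ⟩
    ΣFin q (λ i → fiber 1# (π ⟨$⟩ʳ i))       ≡⟨ ≡.sym (ΣFin-bijection (translation x₀) (fiber 1#)) ⟩
    ΣFin q (fiber 1#)                        ≡⟨ ΣFin-split-zero (fiber 1#) ⟩
    traceFiber 1# + 𝟙 (tr0 ≟ 1#)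
      ≡⟨ ≡.cong (traceFiber 1# +_) (𝟙-no (tr0 ≟ 1#) (λ tr0≈1 → 1≉0 (trans (sym tr0≈1) tr0≈0))) ⟩
    traceFiber 1# + 0                        ≡⟨ ℕ.+-identityʳ _ ⟩
    traceFiber 1#                            ∎
    where
    open ≡.≡-Reasoning
    x₀ = proj₁ tr-takes-value-1#
    π = permute (translation x₀)
    tr0 = tr (enum (index 0#))
    tr0≈0 : tr0 ≈ 0#
    tr0≈0 = trans (tr-cong (enum-index 0#)) tr-0#
    fiber : Carrier → Fin q → ℕ
    fiber b i = 𝟙 (tr (enum i) ≟ b)
    translate : ∀ i → fiber 1# (π ⟨$⟩ʳ i) ≡ fiber 0# i
    translate i = ≡.trans
      (𝟙-≈ (trans (tr-cong (enum-permute (translation x₀) i))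
                  (trans (tr-+ (enum i) x₀) (+-congˡ (proj₂ tr-takes-value-1#))))
           (sym (+-identityˡ 1#)))
      (𝟙-cong (+-cancelʳ 1# _ _) +-congʳ ((tr (enum i) ⊕ 1#) ≟ (0# ⊕ 1#)) (tr (enum i) ≟ 0#))

  T≡traceCount : ∀ i j → T F p m i j ≡ traceCount (nat i) (nat j)
  T≡traceCount i j = ≡.trans
    (ΣFin-cong q (λ x → ΣFin-cong q (λ y →
      ≡.trans (𝟙-× ((enum x ⊗ enum y) ≟ 1#) ((tr (enum x) ≟ nat i) ×-dec (tr (enum y) ≟ nat j)))
      (≡.cong (𝟙 ((enum x ⊗ enum y) ≟ 1#) *_) (𝟙-× (tr (enum x) ≟ nat i) (tr (enum y) ≟ nat j))))))
    (ΣFin-inverse-pairs (λ x y → 𝟙 (tr x ≟ nat i) * 𝟙 (tr y ≟ nat j))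
      (λ x y≈y′ → ≡.cong (𝟙 (tr x ≟ nat i) *_) (𝟙-≈ (tr-cong y≈y′) refl)))

  KloostermanM≡Σ* : ∀ {v} → InPrimeField v → ∀ a →
    KloostermanM F p m v a ≡ Σ* (λ x → 𝟙 ((tr x ⊕ v ⊗ tr (inv x)) ≟ residue a))
  KloostermanM≡Σ* {v} v∈𝔽ₚ a = begin
    KloostermanM F p m v a
      ≡⟨ ΣFin-cong q (λ x → ΣFin-cong q (λ y →
           𝟙-× ((enum x ⊗ enum y) ≟ 1#) (tr (enum x ⊕ v ⊗ enum y) ≟ residue a))) ⟩
    ΣFin q (λ x → ΣFin q (λ y → 𝟙 ((enum x ⊗ enum y) ≟ 1#) * 𝟙 (tr (enum x ⊕ v ⊗ enum y) ≟ residue a)))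
      ≡⟨ ΣFin-inverse-pairs (λ x y → 𝟙 (tr (x ⊕ v ⊗ y) ≟ residue a))
           (λ x y≈y′ → 𝟙-≈ (tr-cong (+-congˡ (*-congˡ y≈y′))) refl) ⟩
    Σ* (λ x → 𝟙 (tr (x ⊕ v ⊗ inv x) ≟ residue a))
      ≡⟨ Σ*-cong {λ x → 𝟙 (tr (x ⊕ v ⊗ inv x) ≟ residue a)}
           (λ x _ → 𝟙-≈ (trans (tr-+ x (v ⊗ inv x)) (+-congˡ (tr-*ˡ v∈𝔽ₚ (inv x)))) refl) ⟩
    Σ* (λ x → 𝟙 ((tr x ⊕ v ⊗ tr (inv x)) ≟ residue a)) ∎
    where open ≡.≡-Reasoning

  -- The coefficient of ω^a in 𝒦(w), counted inside 𝔽ₚ ⊆ 𝔽_q.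
  kloostermanₚ : Carrier → Carrier → ℕ
  kloostermanₚ w a = ΣFin p′ (λ k → 𝟙 ((unit k ⊕ w ⊗ inv (unit k)) ≟ a))

  kloostermanₚ-cong : ∀ {w w′} a → w ≈ w′ → kloostermanₚ w a ≡ kloostermanₚ w′ a
  kloostermanₚ-cong a w≈w′ = ΣFin-cong p′ (λ k → 𝟙-≈ (+-congˡ (*-congʳ w≈w′)) refl)

  KloostermanM-by-traces : ∀ {v} → InPrimeField v → ∀ a →
    KloostermanM F p m v a
    ≡ 𝟙 ((0# ⊕ v ⊗ 0#) ≟ residue a) * T₀₀
      + (ΣFin p′ (λ k → 𝟙 ((0# ⊕ v ⊗ unit k) ≟ residue a)) + ΣFin p′ (λ k → 𝟙 ((unit k ⊕ v ⊗ 0#) ≟ residue a))) * T₀₁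
      + ΣFin p′ (λ c → T₁ (unit c) * kloostermanₚ (v ⊗ unit c) (residue a))
  KloostermanM-by-traces {v} v∈𝔽ₚ a = ≡.trans (KloostermanM≡Σ* v∈𝔽ₚ a) (≡.trans
    (Σ*-traces (λ x y → 𝟙 ((x ⊕ v ⊗ y) ≟ residue a)) (λ x≈x′ y≈y′ → 𝟙-≈ (+-cong x≈x′ (*-congˡ y≈y′)) refl))
    (≡.cong (axes +_) (ΣFin-cong p′ (λ c → ≡.cong (T₁ (unit c) *_) (ΣFin-cong p′ (λ k →
      𝟙-≈ (+-congˡ (solve 3 (λ v u c → v :* (u :* c) := (v :* c) :* u) refl v (inv (unit k)) (unit c))) refl))))))
    where
    axes = 𝟙 ((0# ⊕ v ⊗ 0#) ≟ residue a) * T₀₀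
      + (ΣFin p′ (λ k → 𝟙 ((0# ⊕ v ⊗ unit k) ≟ residue a)) + ΣFin p′ (λ k → 𝟙 ((unit k ⊕ v ⊗ 0#) ≟ residue a))) * T₀₁

  Kloosterman₁≡kloostermanₚ : ∀ w a → Kloosterman₁ p w a ≡ kloostermanₚ (nat w) (residue a)
  Kloosterman₁≡kloostermanₚ w a = ≡.trans (ΣFin-cong p (λ x → ΣFin-cong p (λ y → in-field x y)))
    (≡.cong₂ _+_ zero-row (ΣFin-cong p′ unit-row))
    where
    line : Fin p → Fin p → ℕ
    line x y = 𝟙 ((residue x ⊕ nat w ⊗ residue y) ≟ residue a)
    in-field : ∀ x y →
      𝟙 (((toℕ x * toℕ y) % p ℕ.≟ 1) ×-dec ((toℕ x + w * toℕ y) % p ℕ.≟ toℕ a))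
      ≡ 𝟙 ((residue x ⊗ residue y) ≟ 1#) * line x y
    in-field x y = ≡.trans (𝟙-× ((toℕ x * toℕ y) % p ℕ.≟ 1) ((toℕ x + w * toℕ y) % p ℕ.≟ toℕ a))
      (≡.cong₂ _*_
        (≡.trans (𝟙-% (toℕ x * toℕ y) 1<p) (𝟙-≈ (nat-* (toℕ x) (toℕ y)) (+-identityʳ 1#)))
        (≡.trans (𝟙-% (toℕ x + w * toℕ y) (Fin.toℕ<n a))
          (𝟙-≈ (trans (nat-+ (toℕ x) (w * toℕ y)) (+-congˡ (nat-* w (toℕ y)))) refl)))
    zero-row : ΣFin p (λ y → 𝟙 ((0# ⊗ residue y) ≟ 1#) * line fzero y) ≡ 0
    zero-row = ΣFin-𝟙-none p (λ y → (0# ⊗ residue y) ≟ 1#) (line fzero)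
      (λ y 0≈1 → 1≉0 (trans (sym 0≈1) (zeroˡ (residue y))))
    unit-row : ∀ k → ΣFin p (λ y → 𝟙 ((unit k ⊗ residue y) ≟ 1#) * line (fsuc k) y)
                     ≡ 𝟙 ((unit k ⊕ nat w ⊗ inv (unit k)) ≟ residue a)
    unit-row k = ≡.trans
      (ΣFin-cong p (λ y → ≡.cong (_* line (fsuc k) y)
        (𝟙-cong (λ uy≈1 → sym (inverse-unique (unit-nonzero k) uy≈1))
                (λ u⁻¹≈y → trans (*-congˡ (sym u⁻¹≈y)) (*-inverseʳ (unit k) (unit-nonzero k)))
                ((unit k ⊗ residue y) ≟ 1#) (inv (unit k) ≟ residue y))))
      (ΣFin-residue-expand (InPrimeField-inv (InPrimeField-unit k))
        (λ b → 𝟙 ((unit k ⊕ nat w ⊗ b) ≟ residue a)) (λ b≈b′ → 𝟙-≈ (+-congˡ (*-congˡ b≈b′)) refl))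

module PrimitiveRoot {c ℓ} (p′ m′ : ℕ) (p-prime : Prime (suc p′)) (F : FiniteField c ℓ (suc p′ ^ suc m′))
                     (g : ℕ) (g-primitive : IsPrimitiveRoot (suc p′) g) where

  open TraceCounts p′ m′ p-prime F public
  open import Data.Nat using (_/_)
  open import Data.Nat.DivMod using (m≡m%n+[m/n]*n; m%n<n)

  γ : Carrier
  γ = nat g

  γ-nonzero : ¬ γ ≈ 0#
  γ-nonzero = nat-nonzero (proj₁ g-primitive) (proj₁ (proj₂ g-primitive))

  γ^p′≈1 : pow γ p′ ≈ 1#
  γ^p′≈1 = sym (*-cancelˡ-nonzero γ-nonzero (trans (*-identityʳ γ) (sym (InPrimeField-nat g))))

  nat-g^k%p : ∀ k → nat ((g ^ k) % p) ≈ pow γ k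
  nat-g^k%p k = trans (sym (nat-% (g ^ k))) (nat-^ g k)

  -- The exponent is reduced modulo suc (p ∸ 2), which is p - 1 since p ≥ 2.
  pow-γ-% : ∀ n → pow γ (n % suc (p ∸ 2)) ≈ pow γ n
  pow-γ-% n = sym (begin
    pow γ n                                        ≡⟨ ≡.cong (pow γ) (m≡m%n+[m/n]*n n n₁) ⟩
    pow γ (n % n₁ + (n / n₁) * n₁)                 ≈⟨ pow-+ γ (n % n₁) _ ⟩
    pow γ (n % n₁) ⊗ pow γ ((n / n₁) * n₁)         ≈⟨ *-congˡ (reflexive (≡.cong (pow γ) (ℕ.*-comm (n / n₁) n₁))) ⟩
    pow γ (n % n₁) ⊗ pow γ (n₁ * (n / n₁))         ≈⟨ *-congˡ (pow-* γ n₁ (n / n₁)) ⟩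
    pow γ (n % n₁) ⊗ pow (pow γ n₁) (n / n₁)       ≈⟨ *-congˡ (trans (pow-cong (n / n₁) γ^n₁≈1) (pow-1# (n / n₁))) ⟩
    pow γ (n % n₁) ⊗ 1#                            ≈⟨ *-identityʳ _ ⟩
    pow γ (n % n₁)                                 ∎)
    where
    open ≈-Reasoning
    n₁ = suc (p ∸ 2)
    γ^n₁≈1 : pow γ n₁ ≈ 1#
    γ^n₁≈1 = trans (reflexive (≡.cong (pow γ) (ℕ.suc-pred p′ {{>-nonZero (ℕ.≤-pred 1<p)}}))) γ^p′≈1

  pow-γ-distinct : ∀ {l l′} → l < l′ → l′ < p′ → ¬ pow γ l ≈ pow γ l′
  pow-γ-distinct {l} {l′} l<l′ l′<p′ γˡ≈γˡ′ with ℕ.m≤n⇒∃[o]m+o≡n l<l′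
  ... | d , l+1+d≡l′ = proj₂ (proj₂ g-primitive) (suc d) (s≤s z≤n) 1+d<p′ g^[1+d]%p≡1
    where
    l+[1+d]≡l′ : l + suc d ≡ l′
    l+[1+d]≡l′ = ≡.trans (ℕ.+-suc l d) l+1+d≡l′
    1+d<p′ : suc d < p′
    1+d<p′ = ℕ.≤-<-trans (≡.subst (suc d ≤_) l+[1+d]≡l′ (ℕ.m≤n+m (suc d) l)) l′<p′
    γ^[1+d]≈1 : pow γ (suc d) ≈ 1#
    γ^[1+d]≈1 = sym (*-cancelˡ-nonzero (pow-nonzero l γ-nonzero) (begin
      pow γ l ⊗ 1#                  ≈⟨ *-identityʳ _ ⟩
      pow γ l                       ≈⟨ γˡ≈γˡ′ ⟩
      pow γ l′                      ≡⟨ ≡.cong (pow γ) (≡.sym l+[1+d]≡l′) ⟩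
      pow γ (l + suc d)             ≈⟨ pow-+ γ l (suc d) ⟩
      pow γ l ⊗ pow γ (suc d)       ∎))
      where open ≈-Reasoning
    g^[1+d]%p≡1 : (g ^ suc d) % p ≡ 1
    g^[1+d]%p≡1 = nat-injective (m%n<n (g ^ suc d) p) 1<p
      (trans (nat-g^k%p (suc d)) (trans γ^[1+d]≈1 (sym (+-identityʳ 1#))))

  pow-γ-injective : ∀ {l l′} → l < p′ → l′ < p′ → pow γ l ≈ pow γ l′ → l ≡ l′
  pow-γ-injective {l} {l′} l<p′ l′<p′ γˡ≈γˡ′ with ℕ.<-cmp l l′
  ... | tri≈ _ l≡l′ _ = l≡l′
  ... | tri< l<l′ _ _ = contradiction γˡ≈γˡ′ (pow-γ-distinct l<l′ l′<p′)
  ... | tri> _ _ l′<l = contradiction (sym γˡ≈γˡ′) (pow-γ-distinct l′<l l<p′)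

  ΣFin-powers-γ : (H : Carrier → ℕ) → H Preserves _≈_ ⟶ _≡_ →
    ΣFin p′ (λ l → H (pow γ (toℕ l))) ≡ ΣFin p′ (λ c → H (unit c))
  ΣFin-powers-γ = ΣFin-units-reindex (λ l → pow γ (toℕ l))
    (λ l → InPrimeField-pow (InPrimeField-nat g) (toℕ l)) (λ l → pow-nonzero (toℕ l) γ-nonzero)
    (λ γˡ≈γˡ′ → Fin.toℕ-injective (pow-γ-injective (Fin.toℕ<n _) (Fin.toℕ<n _) γˡ≈γˡ′))

  v : ℕ → Carrier
  v s = nat ((g ^ s) % p)

  v-nonzero : ∀ s → ¬ v s ≈ 0#
  v-nonzero s v≈0 = pow-nonzero s γ-nonzero (trans (sym (nat-g^k%p s)) v≈0)

  InPrimeField-v : ∀ s → InPrimeField (v s)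
  InPrimeField-v s = InPrimeField-nat ((g ^ s) % p)

  -- The coefficient of ω^a in Σ_{c ∈ 𝔽ₚ^*} T_{1c} 𝒦(v c).
  M : ℕ → Fin p → ℕ
  M s a = ΣFin p′ (λ c → T₁ (unit c) * kloostermanₚ (v s ⊗ unit c) (residue a))

  lhs : ℕ → Fin p → ℕ
  lhs s a = ΣFin (p ∸ 1) (λ l → (Kloosterman₁ p ((g ^ ((s + toℕ l) % suc (p ∸ 2))) % p) a + constω {p} (p + 1) a)
                               * T F p m 1 ((g ^ toℕ l) % p))

  Kloosterman₁-shifted : ∀ s l a →
    Kloosterman₁ p ((g ^ ((s + l) % suc (p ∸ 2))) % p) a ≡ kloostermanₚ (v s ⊗ pow γ l) (residue a)
  Kloosterman₁-shifted s l a = ≡.trans (Kloosterman₁≡kloostermanₚ ((g ^ ((s + l) % suc (p ∸ 2))) % p) a)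
    (kloostermanₚ-cong (residue a) (begin
      nat ((g ^ ((s + l) % suc (p ∸ 2))) % p) ≈⟨ nat-g^k%p ((s + l) % suc (p ∸ 2)) ⟩
      pow γ ((s + l) % suc (p ∸ 2))           ≈⟨ pow-γ-% (s + l) ⟩
      pow γ (s + l)                           ≈⟨ pow-+ γ s l ⟩
      pow γ s ⊗ pow γ l                       ≈⟨ *-congʳ (sym (nat-g^k%p s)) ⟩
      v s ⊗ pow γ l                           ∎))
    where open ≈-Reasoning

  T-power : ∀ l → T F p m 1 ((g ^ l) % p) ≡ T₁ (pow γ l)
  T-power l = ≡.trans (T≡traceCount 1 ((g ^ l) % p)) (traceCount-cong (+-identityʳ 1#) (nat-g^k%p l))

  lhs-reindexed : ∀ s a → lhs s a ≡ M s a + constω {p} (p + 1) a * S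
  lhs-reindexed s a = begin
    ΣFin p′ (λ l → (Kloosterman₁ p ((g ^ ((s + toℕ l) % suc (p ∸ 2))) % p) a + cst) * T F p m 1 ((g ^ toℕ l) % p))
      ≡⟨ ΣFin-cong p′ (λ l →
           ≡.cong₂ (λ k n → (k + cst) * n) (Kloosterman₁-shifted s (toℕ l) a) (T-power (toℕ l))) ⟩
    ΣFin p′ (λ l → H (pow γ (toℕ l)))
      ≡⟨ ΣFin-powers-γ H (λ z≈z′ → ≡.cong₂ (λ k n → (k + cst) * n)
           (kloostermanₚ-cong (residue a) (*-congˡ z≈z′)) (traceCount-cong refl z≈z′)) ⟩
    ΣFin p′ (λ c → H (unit c))
      ≡⟨ ΣFin-cong p′ (λ c → ≡.trans (ℕ.*-distribʳ-+ (T₁ (unit c)) (K c) cst)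
                              (≡.cong (_+ cst * T₁ (unit c)) (ℕ.*-comm (K c) (T₁ (unit c))))) ⟩
    ΣFin p′ (λ c → T₁ (unit c) * kloostermanₚ (v s ⊗ unit c) (residue a) + cst * T₁ (unit c))
      ≡⟨ ΣFin-distrib-+ p′ (λ c → T₁ (unit c) * K c) (λ c → cst * T₁ (unit c)) ⟩
    M s a + ΣFin p′ (λ c → cst * T₁ (unit c))
      ≡⟨ ≡.cong (M s a +_) (ΣFin-*ˡ p′ cst (λ c → T₁ (unit c))) ⟩
    M s a + cst * S ∎
    where
    open ≡.≡-Reasoning
    cst = constω {p} (p + 1) a
    H : Carrier → ℕ
    H z = (kloostermanₚ (v s ⊗ z) (residue a) + cst) * T₁ z
    K : Fin p′ → ℕ
    K c = kloostermanₚ (v s ⊗ unit c) (residue a)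

  KloostermanM-at-0 : ∀ s → KloostermanM F p m (v s) fzero ≡ T₀₀ + M s fzero
  KloostermanM-at-0 s = begin
    KloostermanM F p m (v s) fzero
      ≡⟨ KloostermanM-by-traces (InPrimeField-v s) fzero ⟩
    𝟙 ((0# ⊕ v s ⊗ 0#) ≟ 0#) * T₀₀ + (ΣFin p′ (λ k → 𝟙 ((0# ⊕ v s ⊗ unit k) ≟ 0#))
      + ΣFin p′ (λ k → 𝟙 ((unit k ⊕ v s ⊗ 0#) ≟ 0#))) * T₀₁ + M s fzero
      ≡⟨ ≡.cong (_+ M s fzero) (≡.cong₂ _+_ (≡.cong (_* T₀₀) at-origin) (≡.cong (_* T₀₁) (≡.cong₂ _+_
           (≡.trans (ΣFin-cong p′ (λ k → 𝟙-no ((0# ⊕ v s ⊗ unit k) ≟ 0#) (λ e → *-nonzero (v-nonzero s) (unit-nonzero k)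
                      (trans (sym (+-identityˡ _)) e)))) (ΣFin-zero p′))
           (≡.trans (ΣFin-cong p′ (λ k → 𝟙-no ((unit k ⊕ v s ⊗ 0#) ≟ 0#) (λ e → unit-nonzero k
                      (trans (sym (trans (+-congˡ (zeroʳ (v s))) (+-identityʳ _))) e)))) (ΣFin-zero p′))))) ⟩
    (1 * T₀₀ + 0 * T₀₁) + M s fzero
      ≡⟨ ≡.cong (_+ M s fzero) (≡.trans (ℕ.+-identityʳ _) (ℕ.*-identityˡ T₀₀)) ⟩
    T₀₀ + M s fzero ∎
    where
    open ≡.≡-Reasoning
    at-origin : 𝟙 ((0# ⊕ v s ⊗ 0#) ≟ 0#) ≡ 1
    at-origin = 𝟙-yes ((0# ⊕ v s ⊗ 0#) ≟ 0#) (trans (+-identityˡ _) (zeroʳ (v s)))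

  KloostermanM-at-unit : ∀ s a → KloostermanM F p m (v s) (fsuc a) ≡ 2 * T₀₁ + M s (fsuc a)
  KloostermanM-at-unit s a = begin
    KloostermanM F p m (v s) (fsuc a)
      ≡⟨ KloostermanM-by-traces (InPrimeField-v s) (fsuc a) ⟩
    𝟙 ((0# ⊕ v s ⊗ 0#) ≟ unit a) * T₀₀ + (ΣFin p′ (λ k → 𝟙 ((0# ⊕ v s ⊗ unit k) ≟ unit a))
      + ΣFin p′ (λ k → 𝟙 ((unit k ⊕ v s ⊗ 0#) ≟ unit a))) * T₀₁ + M s (fsuc a)
      ≡⟨ ≡.cong (_+ M s (fsuc a)) (≡.cong₂ _+_ (≡.cong (_* T₀₀) at-origin)
           (≡.cong (_* T₀₁) (≡.cong₂ _+_ on-column on-row))) ⟩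
    (0 * T₀₀ + (1 + 1) * T₀₁) + M s (fsuc a) ∎
    where
    open ≡.≡-Reasoning
    v≉0 = v-nonzero s
    v∈𝔽ₚ = InPrimeField-v s
    at-origin : 𝟙 ((0# ⊕ v s ⊗ 0#) ≟ unit a) ≡ 0
    at-origin = 𝟙-no ((0# ⊕ v s ⊗ 0#) ≟ unit a)
      (λ e → unit-nonzero a (trans (sym e) (trans (+-identityˡ _) (zeroʳ (v s)))))
    on-column : ΣFin p′ (λ k → 𝟙 ((0# ⊕ v s ⊗ unit k) ≟ unit a)) ≡ 1
    on-column = ≡.trans
      (ΣFin-cong p′ (λ k → 𝟙-cong
        (λ e → trans (sym (inv-*-cancelˡ v≉0 (unit k))) (*-congˡ (trans (sym (+-identityˡ _)) e)))
        (λ e → trans (+-identityˡ _) (trans (*-congˡ e) (*-inv-cancelˡ v≉0 (unit a))))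
        ((0# ⊕ v s ⊗ unit k) ≟ unit a) (unit k ≟ (inv (v s) ⊗ unit a))))
      (ΣFin-unit-δ₁ (InPrimeField-⊗ (InPrimeField-inv v∈𝔽ₚ) (InPrimeField-unit a))
                    (*-nonzero (inv-nonzero v≉0) (unit-nonzero a)))
    on-row : ΣFin p′ (λ k → 𝟙 ((unit k ⊕ v s ⊗ 0#) ≟ unit a)) ≡ 1
    on-row = ≡.trans (ΣFin-cong p′ (λ k → 𝟙-≈ (trans (+-congˡ (zeroʳ (v s))) (+-identityʳ _)) refl))
      (ΣFin-unit-δ₁ (InPrimeField-unit a) (unit-nonzero a))

  q-by-traces : q ≡ T₀₀ + (p′ + p′) * T₀₁ + S * p′ + 1
  q-by-traces = ≡.trans (≡.sym nonzero-count) (≡.cong (_+ 1) nonzero-count-by-traces)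

  trace-balance : T₀₀ + p′ * T₀₁ + 1 ≡ T₀₁ + S
  trace-balance = ≡.trans (≡.cong (_+ 1) (≡.sym traceFiber-0#)) (≡.trans traceFiber-balanced traceFiber-1#)

  sides-differ-by-2T₀₁ : ∀ s a →
    lhs s a + 2 * T₀₁
    ≡ KloostermanM F p m (v s) a + constω {p} (p ^ m + 1) a
  sides-differ-by-2T₀₁ s fzero = begin
    lhs s fzero + 2 * T₀₁                      ≡⟨ ≡.cong (_+ 2 * T₀₁) (lhs-reindexed s fzero) ⟩
    (M s fzero + (p + 1) * S) + 2 * T₀₁
      ≡⟨ constant-term-identity {p′} {T₀₀} {T₀₁} {S} {q} (M s fzero) q-by-traces trace-balance ⟩
    (T₀₀ + M s fzero) + (q + 1)                ≡⟨ ≡.cong (_+ (q + 1)) (≡.sym (KloostermanM-at-0 s)) ⟩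
    KloostermanM F p m (v s) fzero + (q + 1)   ∎
    where open ≡.≡-Reasoning
  sides-differ-by-2T₀₁ s (fsuc a) = begin
    lhs s (fsuc a) + 2 * T₀₁                   ≡⟨ ≡.cong (_+ 2 * T₀₁) (lhs-reindexed s (fsuc a)) ⟩
    (M s (fsuc a) + 0 * S) + 2 * T₀₁
      ≡⟨ ≡.trans (≡.cong (_+ 2 * T₀₁) (ℕ.+-identityʳ (M s (fsuc a)))) (ℕ.+-comm (M s (fsuc a)) (2 * T₀₁)) ⟩
    2 * T₀₁ + M s (fsuc a)                     ≡⟨ ≡.sym (≡.trans (ℕ.+-identityʳ _) (KloostermanM-at-unit s a)) ⟩
    KloostermanM F p m (v s) (fsuc a) + 0      ∎
    where open ≡.≡-Reasoning

proposition6 : ∀ {c ℓ : Level} (p m : ℕ) .{{_ : NonZero p}} → Prime p → 1 ≤ m →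
    (F : FiniteField c ℓ (p ^ m)) →
    (g : ℕ) → IsPrimitiveRoot p g →
    ∀ (s : ℕ) → s < p ∸ 1 →
      (λ a → ΣFin (p ∸ 1) (λ l →
               (Kloosterman₁ p ((g ^ ((s + toℕ l) % suc (p ∸ 2))) % p) a
                 + constω {p} (p + 1) a)
               * T F p m 1 ((g ^ toℕ l) % p)))
      ≈ω
      (λ a → KloostermanM F p m (FiniteField.nat F ((g ^ s) % p)) a
               + constω {p} (p ^ m + 1) a)
proposition6 zero m p-prime with prime⇒nonZero p-prime
... | ()
proposition6 (suc p′) (suc m′) p-prime _ F g g-primitive s _ =
  ≈ω-offset (2 * T₀₁) (sides-differ-by-2T₀₁ s)
  where open PrimitiveRoot p′ m′ p-prime F g g-primitive
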